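{- Let $s\geq t\geq 2$ be integers. If $G$ is an $r$-regular graph with $H=K_{t,s}$ as a star complement for the eigenvalue $-1$, then $r\equiv -1 \pmod{\frac{ts-1}{\gcd(s-1,t-1)}}$ and $G\cong G(r)$, where $G(r)$ is the graph defined as follows. Let $H=K_{t,s}$ have bipartition $(V,W)$ with $V=\{v_1,\dots,v_t\}$, $W=\{w_1,\dots,w_s\}$. The vertex set of $G(r)$ is $V\cup W\cup X$ with $X=V_1\cup\cdots\cup V_t\cup W_1\cup\cdots\cup W_s$ (disjoint), where $|V_i|=\frac{(r+1)(s-1)}{ts-1}-1$ for $1\le i\le t$ and $|W_j|=\frac{(r+1)(t-1)}{ts-1}-1$ for $1\le j\le s$. The edges are: all edges of $K_{t,s}$ between $V$ and $W$; each vertex of $V_i$ is adjacent to $v_i$ and to all vertices of $W$ (and to no other vertex of $V$); each vertex of $W_j$ is adjacent to $w_j$ and to all vertices of $V$ (and to no other vertex of $W$); each $V_i$ and each $W_j$ induces a clique; every vertex of $V_i$ is adjacent to every vertex of $W_j$ for all $i,j$; there are no edges between $V_i$ and $V_{i'}$ for $i\neq i'$, nor between $W_j$ and $W_{j'}$ for $j\ne j'$.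
   Context: All graphs are finite and simple; eigenvalues are eigenvalues of the adjacency matrix. If $\mu$ is an eigenvalue of a graph $G$ with multiplicity $k\geq 1$, a star set for $\mu$ in $G$ is a vertex subset $X\subseteq V(G)$ with $|X|=k$ such that $\mu$ is not an eigenvalue of the induced subgraph $G-X$; $H=G-X$ is then a star complement for $\mu$. "$G$ has $K_{t,s}$ as a star complement for $\mu$" means some star set $X$ for $\mu$ satisfies $G-X\cong K_{t,s}$. -}

module Defs where

open import Data.Nat as ℕ using (ℕ; zero; suc; _≤_; s≤s; z≤n; NonZero; ≢-nonZero)
open import Data.Nat.GCD using (gcd; gcd[m,n]≢0)
open import Data.Nat.DivMod using (_/_)
open import Data.Bool using (Bool; true; false; if_then_else_; _∧_; not)
open import Data.Fin using (Fin; zero; suc; _≟_)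
open import Data.Fin.Subset using (Subset; _∈_; _∉_; ∣_∣)
open import Data.List using (List; map; allFin)
open import Data.Nat.ListAction using (sum)
open import Data.Product using (Σ; ∃; _×_; _,_)
open import Data.Sum using (_⊎_; inj₁; inj₂)
open import Data.Rational using (ℚ; 0ℚ; 1ℚ; _+_; _*_; _-_)
open import Relation.Binary.PropositionalEquality using (_≡_; _≢_)
open import Relation.Nullary using (¬_)
open import Relation.Nullary.Decidable using (⌊_⌋)

record Graph : Set where
  field
    n       : ℕ
    adj     : Fin n → Fin n → Bool
    adj-sym : ∀ i j → adj i j ≡ adj j i
    irrefl  : ∀ i → adj i i ≡ false
open Graph public

degree : (G : Graph) → Fin (n G) → ℕ
degree G i = sum (map (λ j → if adj G i j then 1 else 0) (allFin (n G)))

Regular : Graph → ℕ → Set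
Regular G r = ∀ i → degree G i ≡ r

Σℚ : ∀ {m} → (Fin m → ℚ) → ℚ
Σℚ {zero}  f = 0ℚ
Σℚ {suc m} f = f zero + Σℚ (λ k → f (suc k))

A : (G : Graph) → Fin (n G) → Fin (n G) → ℚ
A G i j = if adj G i j then 1ℚ else 0ℚ

Vecℚ : ℕ → Set
Vecℚ m = Fin m → ℚ

shifted : (G : Graph) → ℚ → Vecℚ (n G) → Fin (n G) → ℚ
shifted G μ v i = Σℚ (λ j → A G i j * v j) - μ * v i

InKer : (G : Graph) → ℚ → Vecℚ (n G) → Set
InKer G μ v = ∀ i → shifted G μ v i ≡ 0ℚ

LinIndep : ∀ {k m} → (Fin k → Vecℚ m) → Set
LinIndep {k} {m} vs =
  ∀ (c : Fin k → ℚ) → (∀ i → Σℚ (λ l → c l * vs l i) ≡ 0ℚ) → ∀ l → c l ≡ 0ℚ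

-- μ has multiplicity k in G: the μ-eigenspace has dimension exactly k
-- (for a symmetric matrix geometric = algebraic multiplicity)
Multiplicity : (G : Graph) → ℚ → ℕ → Set
Multiplicity G μ k =
  (Σ (Fin k → Vecℚ (n G)) λ vs → (∀ l → InKer G μ (vs l)) × LinIndep vs)
  × (∀ (vs : Fin (suc k) → Vecℚ (n G)) → (∀ l → InKer G μ (vs l)) → ¬ LinIndep vs)

-- μ is not an eigenvalue of G - X: the principal submatrix of A - μ I on
-- the rows/columns outside X is nonsingular (trivial kernel)
NotEigenvalueOfDeleted : (G : Graph) → ℚ → Subset (n G) → Set
NotEigenvalueOfDeleted G μ X =
  ∀ (v : Vecℚ (n G)) → (∀ i → i ∈ X → v i ≡ 0ℚ)
    → (∀ i → i ∉ X → shifted G μ v i ≡ 0ℚ) → ∀ i → v i ≡ 0ℚ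

StarSet : (G : Graph) → ℚ → Subset (n G) → Set
StarSet G μ X = 1 ≤ ∣ X ∣ × Multiplicity G μ ∣ X ∣ × NotEigenvalueOfDeleted G μ X

Kadj : ∀ {t s} → Fin t ⊎ Fin s → Fin t ⊎ Fin s → Bool
Kadj (inj₁ _) (inj₁ _) = false
Kadj (inj₁ _) (inj₂ _) = true
Kadj (inj₂ _) (inj₁ _) = true
Kadj (inj₂ _) (inj₂ _) = false

DeletedIsoK : (G : Graph) → Subset (n G) → ℕ → ℕ → Set
DeletedIsoK G X t s =
  Σ (Fin t ⊎ Fin s → Fin (n G)) λ f →
      (∀ z z' → f z ≡ f z' → z ≡ z')
    × (∀ z → f z ∉ X)
    × (∀ v → v ∉ X → ∃ λ z → f z ≡ v)
    × (∀ z z' → adj G (f z) (f z') ≡ Kadj z z')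

HasStarComplementK : Graph → ℚ → ℕ → ℕ → Set
HasStarComplementK G μ t s =
  Σ (Subset (n G)) λ X → StarSet G μ X × DeletedIsoK G X t s

data GV (t s a b : ℕ) : Set where
  v : Fin t → GV t s a b
  w : Fin s → GV t s a b
  x : Fin t → Fin a → GV t s a b   -- x i p ∈ V_i
  y : Fin s → Fin b → GV t s a b   -- y j q ∈ W_j

eqᵇ : ∀ {m} → Fin m → Fin m → Bool
eqᵇ i j = ⌊ i ≟ j ⌋

GAdj : ∀ {t s a b} → GV t s a b → GV t s a b → Bool
GAdj (v _)   (v _)   = false
GAdj (v _)   (w _)   = true
GAdj (v i)   (x i' _) = eqᵇ i i'
GAdj (v _)   (y _ _) = true
GAdj (w _)   (v _)   = true
GAdj (w _)   (w _)   = false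
GAdj (w _)   (x _ _) = true
GAdj (w j)   (y j' _) = eqᵇ j j'
GAdj (x i _) (v i')  = eqᵇ i i'
GAdj (x _ _) (w _)   = true
GAdj (x i p) (x i' p') = eqᵇ i i' ∧ not (eqᵇ p p')
GAdj (x _ _) (y _ _) = true
GAdj (y _ _) (v _)   = true
GAdj (y j _) (w j')  = eqᵇ j j'
GAdj (y _ _) (x _ _) = true
GAdj (y j q) (y j' q') = eqᵇ j j' ∧ not (eqᵇ q q')

IsoToG : (G : Graph) → (t s a b : ℕ) → Set
IsoToG G t s a b =
  Σ (Fin (n G) → GV t s a b) λ φ →
      (∀ i j → φ i ≡ φ j → i ≡ j)
    × (∀ u → ∃ λ i → φ i ≡ u)
    × (∀ i j → adj G i j ≡ GAdj (φ i) (φ j))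

gcdNZ : ∀ t s → 2 ≤ s → NonZero (gcd (s ℕ.∸ 1) (t ℕ.∸ 1))
gcdNZ t (suc zero) (s≤s ())
gcdNZ t (suc (suc s)) _ = ≢-nonZero (gcd[m,n]≢0 (suc s) (t ℕ.∸ 1) (inj₁ λ ()))

modulus : ∀ t s → 2 ≤ s → ℕ
modulus t s hs = _/_ (t ℕ.* s ℕ.∸ 1) (gcd (s ℕ.∸ 1) (t ℕ.∸ 1)) {{gcdNZ t s hs}}

{-# OPTIONS --safe #-}
module Submission where

-- Since -1 is
-- not an eigenvalue of G - X and |X| is the multiplicity of -1, every x ∈ X has
-- a (-1)-eigenvector e with e(x) = 1 vanishing on X ∖ {x}; as r ≠ -1, e is
-- orthogonal to the all-ones vector.  Writing σ_V, σ_W for the sums of e over V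
-- and W, the eigenvalue equations at V, W and x leave (t + s - 2) σ_V (1 + σ_V) = 0,
-- so x is adjacent to all of W and exactly one v_i, or symmetrically.  The equation
-- at y ∈ X ∖ {x} then says y ~ x iff y ~ v_i: x is a twin of v_i, and adjacency in
-- G depends only on whose twin each vertex is.  Counting neighbours of the v_i and
-- w_j shows that the classes V_i all have one size a and the W_j one size b, with
-- r = s + a + s b = t + b + t a, from which the arithmetic follows.

module Arithmetic where

  open import Data.Nat
  open import Data.Nat.Properties
  open import Data.Nat.Solver using (module +-*-Solver)
  open import Data.Nat.GCD using (gcd; gcd[m,n]∣m; gcd[m,n]∣n)
  open import Data.Nat.DivMod using (_/_; m/n*n≡m)
  open import Data.Nat.Divisibility using (_∣_; divides; ∣m∣n⇒∣m+n; ∣-trans; m∣m*n)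
  open import Data.Nat.Coprimality using (coprime-/gcd; coprime-factors)
  open import Data.Product using (_×_; _,_)
  open import Relation.Binary.PropositionalEquality
  open +-*-Solver

  -- With t = 1 + t₁ and s = 1 + s₁, the number t s - 1 is s₁ + t₁ (1 + s₁).
  class-sizes : ∀ t₁ s₁ a b r → r ≡ suc s₁ + a + suc s₁ * b → r ≡ suc t₁ + b + suc t₁ * a →
    suc a * (s₁ + t₁ * suc s₁) ≡ suc r * s₁ × suc b * (s₁ + t₁ * suc s₁) ≡ suc r * t₁
  class-sizes t₁ s₁ a b r r≡ r≡′ = size-a , size-b
    where
    open ≡-Reasoning
    cross : s₁ * suc b ≡ t₁ * suc a
    cross = +-cancelʳ-≡ (suc (a + b)) _ _ (begin
      s₁ * suc b + suc (a + b)  ≡⟨ solve 3 (λ s₁ a b → s₁ :* (con 1 :+ b) :+ (con 1 :+ (a :+ b))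
                                              := con 1 :+ s₁ :+ a :+ (con 1 :+ s₁) :* b) refl s₁ a b ⟩
      suc s₁ + a + suc s₁ * b   ≡⟨ trans (sym r≡) r≡′ ⟩
      suc t₁ + b + suc t₁ * a   ≡⟨ solve 3 (λ t₁ a b → con 1 :+ t₁ :+ b :+ (con 1 :+ t₁) :* a
                                              := t₁ :* (con 1 :+ a) :+ (con 1 :+ (a :+ b))) refl t₁ a b ⟩
      t₁ * suc a + suc (a + b)  ∎)
    suc-r : suc r ≡ suc s₁ * suc b + suc a
    suc-r = trans (cong suc r≡) (solve 3 (λ s₁ a b → con 1 :+ (con 1 :+ s₁ :+ a :+ (con 1 :+ s₁) :* b)
                                            := (con 1 :+ s₁) :* (con 1 :+ b) :+ (con 1 :+ a)) refl s₁ a b)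
    size-a : suc a * (s₁ + t₁ * suc s₁) ≡ suc r * s₁
    size-a = begin
      suc a * (s₁ + t₁ * suc s₁)          ≡⟨ solve 3 (λ A s₁ t₁ → A :* (s₁ :+ t₁ :* (con 1 :+ s₁))
                                                        := s₁ :* A :+ (t₁ :* A) :* (con 1 :+ s₁)) refl (suc a) s₁ t₁ ⟩
      s₁ * suc a + t₁ * suc a * suc s₁    ≡⟨ cong (λ z → s₁ * suc a + z * suc s₁) (sym cross) ⟩
      s₁ * suc a + s₁ * suc b * suc s₁    ≡⟨ solve 3 (λ A B s₁ → s₁ :* A :+ (s₁ :* B) :* (con 1 :+ s₁)
                                                        := ((con 1 :+ s₁) :* B :+ A) :* s₁) refl (suc a) (suc b) s₁ ⟩
      (suc s₁ * suc b + suc a) * s₁       ≡⟨ cong (_* s₁) (sym suc-r) ⟩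
      suc r * s₁                          ∎
    size-b : suc b * (s₁ + t₁ * suc s₁) ≡ suc r * t₁
    size-b = begin
      suc b * (s₁ + t₁ * suc s₁)          ≡⟨ solve 3 (λ B s₁ t₁ → B :* (s₁ :+ t₁ :* (con 1 :+ s₁))
                                                        := s₁ :* B :+ t₁ :* (B :* (con 1 :+ s₁))) refl (suc b) s₁ t₁ ⟩
      s₁ * suc b + t₁ * (suc b * suc s₁)  ≡⟨ cong (_+ t₁ * (suc b * suc s₁)) cross ⟩
      t₁ * suc a + t₁ * (suc b * suc s₁)  ≡⟨ solve 4 (λ A B s₁ t₁ → t₁ :* A :+ t₁ :* (B :* (con 1 :+ s₁))
                                                        := ((con 1 :+ s₁) :* B :+ A) :* t₁) refl (suc a) (suc b) s₁ t₁ ⟩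
      (suc s₁ * suc b + suc a) * t₁       ≡⟨ cong (_* t₁) (sym suc-r) ⟩
      suc r * t₁                          ∎

  /gcd-∣ : ∀ D s t R A B .{{_ : NonZero (gcd s t)}} → gcd s t ∣ D →
    A * D ≡ R * s → B * D ≡ R * t → D / gcd s t ∣ R
  /gcd-∣ D s t R A B g∣D AD≡Rs BD≡Rt =
    coprime-factors (coprime-/gcd s t) (divides A (sym (divide-by-gcd s A AD≡Rs (gcd[m,n]∣m s t)))
                                        , divides B (sym (divide-by-gcd t B BD≡Rt (gcd[m,n]∣n s t))))
    where
    g = gcd s t
    divide-by-gcd : ∀ u C → C * D ≡ R * u → g ∣ u → C * (D / g) ≡ u / g * R
    divide-by-gcd u C CD≡Ru g∣u = *-cancelʳ-≡ _ _ g (begin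
      C * (D / g) * g        ≡⟨ *-assoc C (D / g) g ⟩
      C * (D / g * g)        ≡⟨ cong (C *_) (m/n*n≡m g∣D) ⟩
      C * D                  ≡⟨ CD≡Ru ⟩
      R * u                  ≡⟨ cong (R *_) (sym (m/n*n≡m g∣u)) ⟩
      R * (u / g * g)        ≡⟨ solve 3 (λ R q g → R :* (q :* g) := q :* R :* g) refl R (u / g) g ⟩
      u / g * R * g          ∎)
      where open ≡-Reasoning

  gcd∣ts-1 : ∀ t₁ s₁ → gcd s₁ t₁ ∣ s₁ + t₁ * suc s₁
  gcd∣ts-1 t₁ s₁ = ∣m∣n⇒∣m+n (gcd[m,n]∣m s₁ t₁) (∣-trans (gcd[m,n]∣n s₁ t₁) (m∣m*n (suc s₁)))

open import Defs renaming (v to gv; w to gw; x to gx; y to gy)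

module StarSets where

  open import Data.Bool using (Bool; true; false; if_then_else_; _∧_; _∨_; not)
  open import Data.Empty using (⊥-elim)
  open import Data.Fin as Fin using (Fin; zero; suc; toℕ; fromℕ<)
  import Data.Fin.Properties as Finₚ
  open import Data.Fin.Subset using (Subset; _∈_; _∉_; ∣_∣; inside; outside)
  open import Data.Fin.Subset.Properties using (_∈?_)
  open import Data.Fin.Properties using (any?)
  open import Data.Vec using (_∷_; []; there)
  open import Data.Nat as ℕ using (ℕ; zero; suc; s≤s; z≤n)
  import Data.Nat.Properties as ℕₚ
  open import Data.Product using (Σ; ∃; _×_; _,_; proj₁; proj₂)
  import Data.Integer as ℤ
  open import Data.Rational using (ℚ; 0ℚ; 1ℚ; _+_; _*_; _-_; -_; 1/_; ≢-nonZero; _<_; _≤_; *<*)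
  open import Data.Rational.Properties
    using (_≟_; 1≢0; *-zeroʳ; *-zeroˡ; *-identityʳ; *-identityˡ; +-identityʳ; +-identityˡ; *-inverseˡ;
           ≤-refl; <⇒≤; <-irrefl; <-respˡ-≡; +-mono-<-≤; +-0-group)
  open import Algebra.Properties.Group +-0-group using (∙-cancelˡ; inverseˡ-unique)
  open import Data.Rational.Solver using (module +-*-Solver)
  open import Data.Sum using (_⊎_; inj₁; inj₂; [_,_]′)
  open import Data.Sum.Properties using (inj₁-injective; inj₂-injective)
  open import Function using (_∘_; case_of_)
  open import Data.List using (map; tabulate)
  open import Data.Nat.ListAction using (sum)
  open import Relation.Binary.PropositionalEquality
  open import Relation.Nullary using (¬_; ¬?; yes; no; Dec)

  open +-*-Solver

  𝟙 : Bool → ℚ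
  𝟙 b = if b then 1ℚ else 0ℚ

  𝟙ℕ : Bool → ℕ
  𝟙ℕ b = if b then 1 else 0

  𝟙-idem : ∀ b → 𝟙 b * 𝟙 b ≡ 𝟙 b
  𝟙-idem true = *-identityˡ 1ℚ
  𝟙-idem false = *-zeroˡ 0ℚ

  𝟙-injective : ∀ {b c} → 𝟙 b ≡ 𝟙 c → b ≡ c
  𝟙-injective {true} {true} _ = refl
  𝟙-injective {true} {false} e = ⊥-elim (1≢0 e)
  𝟙-injective {false} {true} e = ⊥-elim (1≢0 (sym e))
  𝟙-injective {false} {false} _ = refl

  eqᵇ-refl : ∀ {m} (a : Fin m) → eqᵇ a a ≡ true
  eqᵇ-refl a with a Fin.≟ a
  ... | yes _ = refl
  ... | no a≢a = ⊥-elim (a≢a refl)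

  eqᵇ-≢ : ∀ {m} {a b : Fin m} → a ≢ b → eqᵇ a b ≡ false
  eqᵇ-≢ {a = a} {b} a≢b with a Fin.≟ b
  ... | yes a≡b = ⊥-elim (a≢b a≡b)
  ... | no _ = refl

  eqᵇ⇒≡ : ∀ {m} {a b : Fin m} → eqᵇ a b ≡ true → a ≡ b
  eqᵇ⇒≡ {a = a} {b} _ with a Fin.≟ b
  eqᵇ⇒≡ _ | yes a≡b = a≡b
  eqᵇ⇒≡ () | no _

  eqᵇ-resp-⇔ : ∀ {m k} {a b : Fin m} {c d : Fin k} → (a ≡ b → c ≡ d) → (c ≡ d → a ≡ b) → eqᵇ a b ≡ eqᵇ c d
  eqᵇ-resp-⇔ {a = a} {b} {c} {d} to from with a Fin.≟ b
  ... | yes refl = sym (subst (λ z → eqᵇ c z ≡ true) (to refl) (eqᵇ-refl c))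
  ... | no a≢b = sym (eqᵇ-≢ (λ c≡d → a≢b (from c≡d)))

  eqᵇ-sym : ∀ {m} (a b : Fin m) → eqᵇ a b ≡ eqᵇ b a
  eqᵇ-sym a b = eqᵇ-resp-⇔ sym sym

  eqᵇ-suc : ∀ {m} (a b : Fin m) → eqᵇ (suc a) (suc b) ≡ eqᵇ a b
  eqᵇ-suc a b = eqᵇ-resp-⇔ Finₚ.suc-injective (cong suc)


  Σℚ-cong : ∀ {m} {f g : Fin m → ℚ} → (∀ i → f i ≡ g i) → Σℚ f ≡ Σℚ g
  Σℚ-cong {zero} _ = refl
  Σℚ-cong {suc m} f≗g = cong₂ _+_ (f≗g zero) (Σℚ-cong (λ i → f≗g (suc i)))

  Σℚ-0 : ∀ {m} → Σℚ {m} (λ _ → 0ℚ) ≡ 0ℚ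
  Σℚ-0 {zero} = refl
  Σℚ-0 {suc m} = trans (+-identityˡ _) (Σℚ-0 {m})

  Σℚ-zero : ∀ {m} (f : Fin m → ℚ) → (∀ i → f i ≡ 0ℚ) → Σℚ f ≡ 0ℚ
  Σℚ-zero {m} f f≗0 = trans (Σℚ-cong f≗0) (Σℚ-0 {m})

  Σℚ-+ : ∀ {m} (f g : Fin m → ℚ) → Σℚ (λ i → f i + g i) ≡ Σℚ f + Σℚ g
  Σℚ-+ {zero} f g = refl
  Σℚ-+ {suc m} f g = trans (cong ((f zero + g zero) +_) (Σℚ-+ (λ i → f (suc i)) (λ i → g (suc i))))
    (solve 4 (λ a b c d → (a :+ b) :+ (c :+ d) := (a :+ c) :+ (b :+ d)) refl (f zero) (g zero) _ _)

  Σℚ-neg : ∀ {m} (f : Fin m → ℚ) → Σℚ (λ i → - f i) ≡ - Σℚ f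
  Σℚ-neg {zero} f = refl
  Σℚ-neg {suc m} f = trans (cong ((- f zero) +_) (Σℚ-neg (λ i → f (suc i))))
    (solve 2 (λ a b → (:- a) :+ (:- b) := :- (a :+ b)) refl (f zero) _)

  Σℚ-- : ∀ {m} (f g : Fin m → ℚ) → Σℚ (λ i → f i - g i) ≡ Σℚ f - Σℚ g
  Σℚ-- f g = trans (Σℚ-+ f (λ i → - g i)) (cong (Σℚ f +_) (Σℚ-neg g))

  *-Σℚ : ∀ {m} (c : ℚ) (f : Fin m → ℚ) → Σℚ (λ i → c * f i) ≡ c * Σℚ f
  *-Σℚ {zero} c f = sym (*-zeroʳ c)
  *-Σℚ {suc m} c f = trans (cong ((c * f zero) +_) (*-Σℚ c (λ i → f (suc i))))
    (solve 3 (λ c a b → c :* a :+ c :* b := c :* (a :+ b)) refl c (f zero) _)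

  Σℚ-* : ∀ {m} (c : ℚ) (f : Fin m → ℚ) → Σℚ (λ i → f i * c) ≡ Σℚ f * c
  Σℚ-* {zero} c f = sym (*-zeroˡ c)
  Σℚ-* {suc m} c f = trans (cong ((f zero * c) +_) (Σℚ-* c (λ i → f (suc i))))
    (solve 3 (λ c a b → a :* c :+ b :* c := (a :+ b) :* c) refl c (f zero) _)

  Σℚ-comm : ∀ {m k} (f : Fin m → Fin k → ℚ) →
    Σℚ (λ i → Σℚ (λ j → f i j)) ≡ Σℚ (λ j → Σℚ (λ i → f i j))
  Σℚ-comm {zero} {k} f = sym (Σℚ-0 {k})
  Σℚ-comm {suc m} f = trans (cong (Σℚ (f zero) +_) (Σℚ-comm (λ i → f (suc i))))
    (sym (Σℚ-+ (f zero) (λ j → Σℚ (λ i → f (suc i) j))))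

  Σℚ-indicator : ∀ {m} (i₀ : Fin m) (g : Fin m → ℚ) → Σℚ (λ i → 𝟙 (eqᵇ i i₀) * g i) ≡ g i₀
  Σℚ-indicator {suc m} zero g =
    trans (cong₂ _+_ (*-identityˡ (g zero)) (Σℚ-zero _ (λ i → *-zeroˡ (g (suc i))))) (+-identityʳ _)
  Σℚ-indicator {suc m} (suc i₀) g =
    trans (cong₂ _+_ (*-zeroˡ (g zero))
            (trans (Σℚ-cong (λ i → cong (λ b → 𝟙 b * g (suc i)) (eqᵇ-suc i i₀))) (Σℚ-indicator i₀ (λ i → g (suc i)))))
          (+-identityˡ _)

  Σℚ-indicatorˡ : ∀ {m} (i₀ : Fin m) (g : Fin m → ℚ) → Σℚ (λ i → 𝟙 (eqᵇ i₀ i) * g i) ≡ g i₀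
  Σℚ-indicatorˡ i₀ g = trans (Σℚ-cong (λ i → cong (λ b → 𝟙 b * g i) (eqᵇ-sym i₀ i))) (Σℚ-indicator i₀ g)

  toℚ : ℕ → ℚ
  toℚ zero = 0ℚ
  toℚ (suc k) = 1ℚ + toℚ k

  toℚ-+ : ∀ a b → toℚ (a ℕ.+ b) ≡ toℚ a + toℚ b
  toℚ-+ zero b = sym (+-identityˡ (toℚ b))
  toℚ-+ (suc a) b = trans (cong (1ℚ +_) (toℚ-+ a b))
    (solve 3 (λ o x y → o :+ (x :+ y) := (o :+ x) :+ y) refl 1ℚ (toℚ a) (toℚ b))

  toℚ-1 : toℚ 1 ≡ 1ℚ
  toℚ-1 = +-identityʳ 1ℚ

  0≤toℚ : ∀ k → 0ℚ ≤ toℚ k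
  0<toℚ-suc : ∀ k → 0ℚ < toℚ (suc k)
  0≤toℚ zero = ≤-refl
  0≤toℚ (suc k) = <⇒≤ (0<toℚ-suc k)
  0<toℚ-suc k = <-respˡ-≡ (+-identityʳ 0ℚ) (+-mono-<-≤ {0ℚ} {1ℚ} (*<* (ℤ.+<+ (s≤s z≤n))) (0≤toℚ k))

  toℚ-suc≢0 : ∀ k → toℚ (suc k) ≢ 0ℚ
  toℚ-suc≢0 k e = <-irrefl (sym e) (0<toℚ-suc k)

  toℚ-injective : ∀ {a b} → toℚ a ≡ toℚ b → a ≡ b
  toℚ-injective {zero} {zero} _ = refl
  toℚ-injective {zero} {suc b} e = ⊥-elim (toℚ-suc≢0 b (sym e))
  toℚ-injective {suc a} {zero} e = ⊥-elim (toℚ-suc≢0 a e)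
  toℚ-injective {suc a} {suc b} e = cong suc (toℚ-injective (∙-cancelˡ 1ℚ _ _ e))

  toℚ-t+s-2≢0 : ∀ {t s} → 2 ℕ.≤ t → 1 ℕ.≤ s → toℚ t + toℚ s - 1ℚ - 1ℚ ≢ 0ℚ
  toℚ-t+s-2≢0 {suc (suc t′)} {suc s′} (s≤s (s≤s _)) (s≤s _) = subst (_≢ 0ℚ) t+s-2≡ (toℚ-suc≢0 (t′ ℕ.+ s′))
    where
    t+s-2≡ : toℚ (suc (t′ ℕ.+ s′)) ≡ toℚ (suc (suc t′)) + toℚ (suc s′) - 1ℚ - 1ℚ
    t+s-2≡ = trans (cong (1ℚ +_) (toℚ-+ t′ s′))
      (solve 2 (λ a b → con 1ℚ :+ (a :+ b) := (con 1ℚ :+ (con 1ℚ :+ a)) :+ (con 1ℚ :+ b) :- con 1ℚ :- con 1ℚ) refl (toℚ t′) (toℚ s′))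

  Σℚ-const : ∀ {m} (c : ℚ) → Σℚ {m} (λ _ → c) ≡ toℚ m * c
  Σℚ-const {zero} c = sym (*-zeroˡ c)
  Σℚ-const {suc m} c = trans (cong (c +_) (Σℚ-const {m} c))
    (solve 2 (λ c x → c :+ x :* c := (con 1ℚ :+ x) :* c) refl c (toℚ m))

  Σℕ : ∀ {m} → (Fin m → ℕ) → ℕ
  Σℕ {zero} f = 0
  Σℕ {suc m} f = f zero ℕ.+ Σℕ (λ i → f (suc i))

  Σℕ-cong : ∀ {m} {f g : Fin m → ℕ} → (∀ i → f i ≡ g i) → Σℕ f ≡ Σℕ g
  Σℕ-cong {zero} _ = refl
  Σℕ-cong {suc m} f≗g = cong₂ ℕ._+_ (f≗g zero) (Σℕ-cong (λ i → f≗g (suc i)))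

  Σℕ-const : ∀ {m} c → Σℕ {m} (λ _ → c) ≡ m ℕ.* c
  Σℕ-const {zero} c = refl
  Σℕ-const {suc m} c = cong (c ℕ.+_) (Σℕ-const {m} c)

  toℚ-Σℕ : ∀ {m} (f : Fin m → ℕ) → toℚ (Σℕ f) ≡ Σℚ (λ i → toℚ (f i))
  toℚ-Σℕ {zero} f = refl
  toℚ-Σℕ {suc m} f = trans (toℚ-+ (f zero) _) (cong (toℚ (f zero) +_) (toℚ-Σℕ (λ i → f (suc i))))

  sum-map-tabulate : ∀ {m k} (g : Fin k → ℕ) (h : Fin m → Fin k) → sum (map g (tabulate h)) ≡ Σℕ (g ∘ h)
  sum-map-tabulate {zero} g h = refl
  sum-map-tabulate {suc m} g h = cong (g (h zero) ℕ.+_) (sum-map-tabulate g (h ∘ suc))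

  count : ∀ {m} → (Fin m → Bool) → ℕ
  count P = Σℕ (λ i → 𝟙ℕ (P i))

  toℚ-count : ∀ {m} (P : Fin m → Bool) → toℚ (count P) ≡ Σℚ (λ i → 𝟙 (P i))
  toℚ-count P = trans (toℚ-Σℕ (λ i → 𝟙ℕ (P i))) (Σℚ-cong (λ i → toℚ-𝟙ℕ (P i)))
    where
    toℚ-𝟙ℕ : ∀ b → toℚ (𝟙ℕ b) ≡ 𝟙 b
    toℚ-𝟙ℕ true = toℚ-1
    toℚ-𝟙ℕ false = refl

  count≤ : ∀ {m} (P : Fin m → Bool) → count P ℕ.≤ m
  count≤ {zero} P = z≤n
  count≤ {suc m} P with P zero
  ... | true = s≤s (count≤ (λ i → P (suc i)))
  ... | false = ℕₚ.m≤n⇒m≤1+n (count≤ (λ i → P (suc i)))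

  count≡m⇒all : ∀ {m} (P : Fin m → Bool) → count P ≡ m → ∀ i → P i ≡ true
  count≡m⇒all {suc m} P e i with P zero in P0
  count≡m⇒all {suc m} P e zero | true = P0
  count≡m⇒all {suc m} P e (suc i) | true = count≡m⇒all (λ i → P (suc i)) (ℕₚ.suc-injective e) i
  ... | false = ⊥-elim (ℕₚ.<-irrefl e (s≤s (count≤ (λ i → P (suc i)))))

  count≡0⇒none : ∀ {m} (P : Fin m → Bool) → count P ≡ 0 → ∀ i → P i ≡ false
  count≡0⇒none {suc m} P e i with P zero in P0
  count≡0⇒none {suc m} P e zero | false = P0
  count≡0⇒none {suc m} P e (suc i) | false = count≡0⇒none (λ i → P (suc i)) e i

  count≡1⇒unique : ∀ {m} (P : Fin m → Bool) → count P ≡ 1 → Σ (Fin m) λ i₀ → ∀ i → P i ≡ eqᵇ i i₀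
  count≡1⇒unique {suc m} P e with P zero in P0
  ... | true = zero , unique
    where
    unique : ∀ i → P i ≡ eqᵇ i zero
    unique zero = trans P0 (sym (eqᵇ-refl {suc m} zero))
    unique (suc i) = count≡0⇒none (λ i → P (suc i)) (ℕₚ.suc-injective e) i
  ... | false = suc i₀ , unique
    where
    rest : Σ (Fin m) λ i₀ → ∀ i → P (suc i) ≡ eqᵇ i i₀
    rest = count≡1⇒unique (λ i → P (suc i)) e
    i₀ : Fin m
    i₀ = proj₁ rest
    unique : ∀ i → P i ≡ eqᵇ i (suc i₀)
    unique zero = P0
    unique (suc i) = trans (proj₂ rest i) (sym (eqᵇ-suc i i₀))

  rank : ∀ {m} (P : Fin m → Bool) → Fin m → ℕ
  rank P zero = 0
  rank P (suc i) = 𝟙ℕ (P zero) ℕ.+ rank (λ j → P (suc j)) i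

  rank<count : ∀ {m} (P : Fin m → Bool) i → P i ≡ true → rank P i ℕ.< count P
  rank<count P zero Pi rewrite Pi = s≤s z≤n
  rank<count P (suc i) Pi = ℕₚ.+-monoʳ-< (𝟙ℕ (P zero)) (rank<count (λ j → P (suc j)) i Pi)

  rank-injective : ∀ {m} (P : Fin m → Bool) i j → P i ≡ true → P j ≡ true → rank P i ≡ rank P j → i ≡ j
  rank-injective P zero zero _ _ _ = refl
  rank-injective P zero (suc j) P0 _ e rewrite P0 = ⊥-elim (ℕₚ.0≢1+n e)
  rank-injective P (suc i) zero _ P0 e rewrite P0 = ⊥-elim (ℕₚ.0≢1+n (sym e))
  rank-injective P (suc i) (suc j) Pi Pj e =
    cong suc (rank-injective (λ k → P (suc k)) i j Pi Pj (ℕₚ.+-cancelˡ-≡ (𝟙ℕ (P zero)) _ _ e))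

  rank-surjective : ∀ {m} (P : Fin m → Bool) k → k ℕ.< count P → Σ (Fin m) λ i → P i ≡ true × rank P i ≡ k
  rank-surjective {suc m} P k k<count with P zero in P0 | k
  ... | true | zero = zero , P0 , refl
  ... | true | suc k = let (i , Pi , rank≡k) = rank-surjective (λ j → P (suc j)) k (ℕₚ.≤-pred k<count)
                       in suc i , Pi , trans (cong (λ b → 𝟙ℕ b ℕ.+ rank (λ j → P (suc j)) i) P0) (cong suc rank≡k)
  ... | false | k = let (i , Pi , rank≡k) = rank-surjective (λ j → P (suc j)) k k<count
                    in suc i , Pi , trans (cong (λ b → 𝟙ℕ b ℕ.+ rank (λ j → P (suc j)) i) P0) rank≡k

  *≡0⇒≡0 : ∀ a b → a ≢ 0ℚ → a * b ≡ 0ℚ → b ≡ 0ℚ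
  *≡0⇒≡0 a b a≢0 ab≡0 = begin
    b                 ≡⟨ sym (*-identityˡ b) ⟩
    1ℚ * b            ≡⟨ cong (_* b) (sym (*-inverseˡ a)) ⟩
    (1/ a * a) * b    ≡⟨ solve 3 (λ a' a b → (a' :* a) :* b := a' :* (a :* b)) refl (1/ a) a b ⟩
    1/ a * (a * b)    ≡⟨ cong (1/ a *_) ab≡0 ⟩
    1/ a * 0ℚ         ≡⟨ *-zeroʳ (1/ a) ⟩
    0ℚ                ∎
    where
    open ≡-Reasoning
    instance _ = ≢-nonZero a≢0

  degree≡count : ∀ (G : Graph) j → degree G j ≡ count (adj G j)
  degree≡count G j = sum-map-tabulate (λ i → 𝟙ℕ (adj G j i)) (λ i → i)

  Dependent : ∀ {k n} → (Fin k → Vecℚ n) → Set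
  Dependent {k} vs = Σ (Fin k → ℚ) λ c → (∃ λ l → c l ≢ 0ℚ) × (∀ i → Σℚ (λ l → c l * vs l i) ≡ 0ℚ)

  SupportedIn : ∀ {n} → Subset n → Vecℚ n → Set
  SupportedIn Y v = ∀ i → i ∉ Y → v i ≡ 0ℚ

  dependent-tail : ∀ {k n} (vs : Fin k → Vecℚ (suc n)) → (∀ l → vs l zero ≡ 0ℚ) →
    Dependent (λ l i → vs l (suc i)) → Dependent vs
  dependent-tail vs vs0 (c , nontrivial , combination) = c , nontrivial , λ where
    zero → Σℚ-zero _ (λ l → trans (cong (c l *_) (vs0 l)) (*-zeroʳ (c l)))
    (suc i) → combination i

  Σℚ-eliminate : ∀ {k} (c m y : Fin k → ℚ) (x : ℚ) →
    - Σℚ (λ l → c l * m l) * x + Σℚ (λ l → c l * y l) ≡ Σℚ (λ l → c l * (y l - m l * x))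
  Σℚ-eliminate c m y x = begin
    - Σℚ (λ l → c l * m l) * x + Σℚ (λ l → c l * y l)
      ≡⟨ solve 3 (λ s x t → (:- s) :* x :+ t := t :- s :* x) refl (Σℚ (λ l → c l * m l)) x _ ⟩
    Σℚ (λ l → c l * y l) - Σℚ (λ l → c l * m l) * x
      ≡⟨ cong (λ z → Σℚ (λ l → c l * y l) - z) (sym (Σℚ-* x (λ l → c l * m l))) ⟩
    Σℚ (λ l → c l * y l) - Σℚ (λ l → c l * m l * x)
      ≡⟨ sym (Σℚ-- (λ l → c l * y l) (λ l → c l * m l * x)) ⟩
    Σℚ (λ l → c l * y l - c l * m l * x)
      ≡⟨ Σℚ-cong (λ l → solve 4 (λ c y m x → c :* y :- c :* m :* x := c :* (y :- m :* x)) refl (c l) (y l) (m l) x) ⟩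
    Σℚ (λ l → c l * (y l - m l * x)) ∎
    where open ≡-Reasoning

  module _ {k n} (vs : Fin (suc k) → Vecℚ (suc n)) (pivot≢0 : vs zero zero ≢ 0ℚ) where

    private
      instance _ = ≢-nonZero pivot≢0

    multiplier : Fin k → ℚ
    multiplier l = vs (suc l) zero * 1/ vs zero zero

    eliminate : Fin k → Vecℚ n
    eliminate l i = vs (suc l) (suc i) - multiplier l * vs zero (suc i)

    eliminate-pivot : ∀ l → vs (suc l) zero - multiplier l * vs zero zero ≡ 0ℚ
    eliminate-pivot l = begin
      vs (suc l) zero - multiplier l * vs zero zero
        ≡⟨ solve 3 (λ a p π → a :- (a :* p) :* π := a :- a :* (p :* π)) refl (vs (suc l) zero) (1/ vs zero zero) (vs zero zero) ⟩
      vs (suc l) zero - vs (suc l) zero * (1/ vs zero zero * vs zero zero)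
        ≡⟨ cong (λ z → vs (suc l) zero - vs (suc l) zero * z) (*-inverseˡ (vs zero zero)) ⟩
      vs (suc l) zero - vs (suc l) zero * 1ℚ
        ≡⟨ solve 1 (λ a → a :- a :* con 1ℚ := con 0ℚ) refl (vs (suc l) zero) ⟩
      0ℚ ∎
      where open ≡-Reasoning

    dependent-eliminate : Dependent eliminate → Dependent vs
    dependent-eliminate (c , (l , cl≢0) , combination) = d , (suc l , cl≢0) , d-combination
      where
      d : Fin (suc k) → ℚ
      d zero = - Σℚ (λ l → c l * multiplier l)
      d (suc l) = c l
      d-combination : ∀ i → Σℚ (λ l → d l * vs l i) ≡ 0ℚ
      d-combination i = trans (Σℚ-eliminate c multiplier (λ l → vs (suc l) i) (vs zero i)) (eliminated i)
        where
        eliminated : ∀ i → Σℚ (λ l → c l * (vs (suc l) i - multiplier l * vs zero i)) ≡ 0ℚ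
        eliminated zero = Σℚ-zero _ (λ l → trans (cong (c l *_) (eliminate-pivot l)) (*-zeroʳ (c l)))
        eliminated (suc i) = combination i

  add-to-first : ∀ {k n} → (vs : Fin (suc (suc k)) → Vecℚ n) → Fin (suc k) → Fin (suc (suc k)) → Vecℚ n
  add-to-first vs l₁ zero i = vs zero i + vs (suc l₁) i
  add-to-first vs l₁ (suc l) i = vs (suc l) i

  dependent-add-to-first : ∀ {k n} (vs : Fin (suc (suc k)) → Vecℚ n) l₁ → Dependent (add-to-first vs l₁) → Dependent vs
  dependent-add-to-first {k} vs l₁ (c , nontrivial , combination) = d , d-nontrivial (c zero ≟ 0ℚ) nontrivial , d-combination
    where
    d : Fin (suc (suc k)) → ℚ
    d zero = c zero
    d (suc l) = c (suc l) + 𝟙 (eqᵇ l l₁) * c zero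
    d-nontrivial : Dec (c zero ≡ 0ℚ) → (∃ λ l → c l ≢ 0ℚ) → ∃ λ l → d l ≢ 0ℚ
    d-nontrivial (no c0≢0) _ = zero , c0≢0
    d-nontrivial (yes c0≡0) (zero , c0≢0) = ⊥-elim (c0≢0 c0≡0)
    d-nontrivial (yes c0≡0) (suc l , cl≢0) = suc l , λ dl≡0 → cl≢0 (begin
      c (suc l)                              ≡⟨ sym (+-identityʳ _) ⟩
      c (suc l) + 0ℚ                         ≡⟨ cong (c (suc l) +_) (sym (*-zeroʳ (𝟙 (eqᵇ l l₁)))) ⟩
      c (suc l) + 𝟙 (eqᵇ l l₁) * 0ℚ          ≡⟨ cong (λ z → c (suc l) + 𝟙 (eqᵇ l l₁) * z) (sym c0≡0) ⟩
      c (suc l) + 𝟙 (eqᵇ l l₁) * c zero      ≡⟨ dl≡0 ⟩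
      0ℚ                                     ∎)
      where open ≡-Reasoning
    d-combination : ∀ i → Σℚ (λ l → d l * vs l i) ≡ 0ℚ
    d-combination i = begin
      c zero * vs zero i + Σℚ (λ l → (c (suc l) + 𝟙 (eqᵇ l l₁) * c zero) * vs (suc l) i)
        ≡⟨ cong (c zero * vs zero i +_) (Σℚ-cong (λ l →
             solve 4 (λ c e c0 v → (c :+ e :* c0) :* v := c :* v :+ e :* (c0 :* v)) refl
               (c (suc l)) (𝟙 (eqᵇ l l₁)) (c zero) (vs (suc l) i))) ⟩
      c zero * vs zero i + Σℚ (λ l → c (suc l) * vs (suc l) i + 𝟙 (eqᵇ l l₁) * (c zero * vs (suc l) i))
        ≡⟨ cong (c zero * vs zero i +_) (trans (Σℚ-+ (λ l → c (suc l) * vs (suc l) i) (λ l → 𝟙 (eqᵇ l l₁) * (c zero * vs (suc l) i)))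
             (cong (Σℚ (λ l → c (suc l) * vs (suc l) i) +_) (Σℚ-indicator l₁ (λ l → c zero * vs (suc l) i)))) ⟩
      c zero * vs zero i + (Σℚ (λ l → c (suc l) * vs (suc l) i) + c zero * vs (suc l₁) i)
        ≡⟨ solve 4 (λ c0 a s b → c0 :* a :+ (s :+ c0 :* b) := c0 :* (a :+ b) :+ s) refl
             (c zero) (vs zero i) (Σℚ (λ l → c (suc l) * vs (suc l) i)) (vs (suc l₁) i) ⟩
      c zero * (vs zero i + vs (suc l₁) i) + Σℚ (λ l → c (suc l) * vs (suc l) i)
        ≡⟨ combination i ⟩
      0ℚ ∎
      where open ≡-Reasoning

  supported-tail : ∀ {n x} {Y : Subset n} {v : Vecℚ (suc n)} → SupportedIn (x ∷ Y) v → SupportedIn Y (λ i → v (suc i))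
  supported-tail supp i i∉Y = supp (suc i) (λ { (there i∈Y) → i∉Y i∈Y })

  supported-eliminate : ∀ {k n} {Y : Subset n} {x} (vs : Fin (suc k) → Vecℚ (suc n)) (pivot≢0 : vs zero zero ≢ 0ℚ) →
    (∀ l → SupportedIn (x ∷ Y) (vs l)) → ∀ l → SupportedIn Y (eliminate vs pivot≢0 l)
  supported-eliminate vs pivot≢0 supp l i i∉Y =
    trans (cong₂ (λ a b → a - multiplier vs pivot≢0 l * b) (supported-tail (supp (suc l)) i i∉Y) (supported-tail (supp zero) i i∉Y))
          (solve 1 (λ m → con 0ℚ :- m :* con 0ℚ := con 0ℚ) refl (multiplier vs pivot≢0 l))

  supported-add-to-first : ∀ {k n} {Y : Subset n} (vs : Fin (suc (suc k)) → Vecℚ n) l₁ →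
    (∀ l → SupportedIn Y (vs l)) → ∀ l → SupportedIn Y (add-to-first vs l₁ l)
  supported-add-to-first vs l₁ supp zero i i∉Y = trans (cong₂ _+_ (supp zero i i∉Y) (supp (suc l₁) i i∉Y)) (+-identityʳ 0ℚ)
  supported-add-to-first vs l₁ supp (suc l) = supp (suc l)

  -- Gaussian elimination on the first coordinate; a vanishing pivot is repaired by
  -- adding to the first vector another one that is nonzero there.
  supported⇒dependent : ∀ {n} (Y : Subset n) k → ∣ Y ∣ ℕ.≤ k →
    (vs : Fin (suc k) → Vecℚ n) → (∀ l → SupportedIn Y (vs l)) → Dependent vs

  pivot⇒dependent : ∀ {n} (Y : Subset n) k → ∣ Y ∣ ℕ.≤ k → (vs : Fin (suc (suc k)) → Vecℚ (suc n)) →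
    vs zero zero ≢ 0ℚ → (∀ l → SupportedIn (inside ∷ Y) (vs l)) → Dependent vs
  pivot⇒dependent Y k |Y|≤k vs pivot≢0 supp = dependent-eliminate vs pivot≢0
    (supported⇒dependent Y k |Y|≤k _ (supported-eliminate vs pivot≢0 supp))

  supported⇒dependent [] k _ vs _ = (λ _ → 1ℚ) , (zero , 1≢0) , λ ()
  supported⇒dependent (outside ∷ Y) k |Y|≤k vs supp =
    dependent-tail vs (λ l → supp l zero λ ())
      (supported⇒dependent Y k |Y|≤k _ (λ l → supported-tail (supp l)))
  supported⇒dependent (inside ∷ Y) (suc k) (s≤s |Y|≤k) vs supp with vs zero zero ≟ 0ℚ
  ... | no pivot≢0 = pivot⇒dependent Y k |Y|≤k vs pivot≢0 supp
  ... | yes pivot≡0 with any? (λ l → ¬? (vs (suc l) zero ≟ 0ℚ))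
  ...   | yes (l₁ , vs-l₁≢0) = dependent-add-to-first vs l₁
    (pivot⇒dependent Y k |Y|≤k _ new-pivot≢0 (supported-add-to-first vs l₁ supp))
    where
    new-pivot≢0 : vs zero zero + vs (suc l₁) zero ≢ 0ℚ
    new-pivot≢0 sum≡0 = vs-l₁≢0 (trans (sym (+-identityˡ _)) (trans (cong (_+ vs (suc l₁) zero) (sym pivot≡0)) sum≡0))
  ...   | no none = dependent-tail vs first≡0
    (supported⇒dependent Y (suc k) (ℕₚ.m≤n⇒m≤1+n |Y|≤k) _ (λ l → supported-tail (supp l)))
    where
    first≡0 : ∀ l → vs l zero ≡ 0ℚ
    first≡0 zero = pivot≡0
    first≡0 (suc l) with vs (suc l) zero ≟ 0ℚ
    ... | yes vs-l≡0 = vs-l≡0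
    ... | no vs-l≢0 = ⊥-elim (none (l , vs-l≢0))

  module _ (G : Graph) (μ : ℚ) where

    InKer-combination : ∀ {k} (c : Fin k → ℚ) (vs : Fin k → Vecℚ (n G)) → (∀ l → InKer G μ (vs l)) →
      InKer G μ (λ j → Σℚ (λ l → c l * vs l j))
    InKer-combination c vs ker i = begin
      Σℚ (λ j → A G i j * Σℚ (λ l → c l * vs l j)) - μ * Σℚ (λ l → c l * vs l i)
        ≡⟨ cong₂ _-_ (trans (Σℚ-cong (λ j → sym (*-Σℚ (A G i j) (λ l → c l * vs l j)))) (Σℚ-comm (λ j l → A G i j * (c l * vs l j))))
                     (sym (*-Σℚ μ (λ l → c l * vs l i))) ⟩
      Σℚ (λ l → Σℚ (λ j → A G i j * (c l * vs l j))) - Σℚ (λ l → μ * (c l * vs l i))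
        ≡⟨ sym (Σℚ-- (λ l → Σℚ (λ j → A G i j * (c l * vs l j))) (λ l → μ * (c l * vs l i))) ⟩
      Σℚ (λ l → Σℚ (λ j → A G i j * (c l * vs l j)) - μ * (c l * vs l i))
        ≡⟨ Σℚ-cong (λ l → trans (cong (_- μ * (c l * vs l i)) (scaled-row l)) (scaled-shift l)) ⟩
      Σℚ (λ l → c l * 0ℚ)
        ≡⟨ Σℚ-zero _ (λ l → *-zeroʳ (c l)) ⟩
      0ℚ ∎
      where
      open ≡-Reasoning
      scaled-row : ∀ l → Σℚ (λ j → A G i j * (c l * vs l j)) ≡ c l * Σℚ (λ j → A G i j * vs l j)
      scaled-row l = trans (Σℚ-cong (λ j → solve 3 (λ a c v → a :* (c :* v) := c :* (a :* v)) refl (A G i j) (c l) (vs l j)))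
                           (*-Σℚ (c l) (λ j → A G i j * vs l j))
      scaled-shift : ∀ l → c l * Σℚ (λ j → A G i j * vs l j) - μ * (c l * vs l i) ≡ c l * 0ℚ
      scaled-shift l = trans (solve 4 (λ c s m v → c :* s :- m :* (c :* v) := c :* (s :- m :* v)) refl (c l) _ μ (vs l i))
                             (cong (c l *_) (ker l i))

    InKer-scale : ∀ (a : ℚ) v → InKer G μ v → InKer G μ (λ j → a * v j)
    InKer-scale a v ker i = begin
      Σℚ (λ j → A G i j * (a * v j)) - μ * (a * v i)
        ≡⟨ cong (_- μ * (a * v i)) (trans (Σℚ-cong (λ j → solve 3 (λ b a v → b :* (a :* v) := a :* (b :* v)) refl (A G i j) a (v j)))
                                           (*-Σℚ a (λ j → A G i j * v j))) ⟩
      a * Σℚ (λ j → A G i j * v j) - μ * (a * v i)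
        ≡⟨ solve 4 (λ a s m v → a :* s :- m :* (a :* v) := a :* (s :- m :* v)) refl a _ μ (v i) ⟩
      a * shifted G μ v i
        ≡⟨ cong (a *_) (ker i) ⟩
      a * 0ℚ
        ≡⟨ *-zeroʳ a ⟩
      0ℚ ∎
      where open ≡-Reasoning

  restrict : ∀ {n} → Subset n → Vecℚ n → Vecℚ n
  restrict X v i with i ∈? X
  ... | yes _ = v i
  ... | no _ = 0ℚ

  restrict-∈ : ∀ {n} (X : Subset n) v {i} → i ∈ X → restrict X v i ≡ v i
  restrict-∈ X v {i} i∈X with i ∈? X
  ... | yes _ = refl
  ... | no i∉X = ⊥-elim (i∉X i∈X)

  restrict-supported : ∀ {n} (X : Subset n) v → SupportedIn X (restrict X v)
  restrict-supported X v i i∉X with i ∈? X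
  ... | yes i∈X = ⊥-elim (i∉X i∈X)
  ... | no _ = refl

  δ : ∀ {m} → Fin m → Vecℚ m
  δ i₀ i = 𝟙 (eqᵇ i i₀)

  δ-diag : ∀ {m} (i₀ : Fin m) → δ i₀ i₀ ≡ 1ℚ
  δ-diag i₀ = cong 𝟙 (eqᵇ-refl i₀)

  δ-off : ∀ {m} {i i₀ : Fin m} → i ≢ i₀ → δ i₀ i ≡ 0ℚ
  δ-off i≢i₀ = cong 𝟙 (eqᵇ-≢ i≢i₀)

  record StarEigenvector (G : Graph) (μ : ℚ) (X : Subset (n G)) (x₀ : Fin (n G)) : Set where
    field
      vec : Vecℚ (n G)
      in-ker : InKer G μ vec
      at-x₀ : vec x₀ ≡ 1ℚ
      off-x₀ : ∀ y → y ∈ X → y ≢ x₀ → vec y ≡ 0ℚ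

  -- The restrictions to X of δ x₀ and of a basis of the eigenspace are |X| + 1 vectors
  -- supported in X, hence dependent; δ x₀ must occur, since a nonzero eigenvector
  -- cannot vanish on X.
  star-eigenvector : (G : Graph) (μ : ℚ) (X : Subset (n G)) → NotEigenvalueOfDeleted G μ X →
    (vs : Fin ∣ X ∣ → Vecℚ (n G)) → (∀ l → InKer G μ (vs l)) → LinIndep vs →
    ∀ x₀ → x₀ ∈ X → StarEigenvector G μ X x₀
  star-eigenvector G μ X not-eigenvalue vs ker independent x₀ x₀∈X = by-first-coefficient (c zero ≟ 0ℚ)
    where
    family : Fin (suc ∣ X ∣) → Vecℚ (n G)
    family zero = restrict X (δ x₀)
    family (suc l) = restrict X (vs l)
    dependence : Dependent family
    dependence = supported⇒dependent X ∣ X ∣ ℕₚ.≤-refl family λ where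
      zero → restrict-supported X (δ x₀)
      (suc l) → restrict-supported X (vs l)
    c : Fin (suc ∣ X ∣) → ℚ
    c = proj₁ dependence
    w : Vecℚ (n G)
    w j = Σℚ (λ l → c (suc l) * vs l j)
    w-ker : InKer G μ w
    w-ker = InKer-combination G μ (λ l → c (suc l)) vs ker
    on-X : ∀ i → i ∈ X → c zero * δ x₀ i + w i ≡ 0ℚ
    on-X i i∈X = trans (cong₂ (λ a b → c zero * a + b) (sym (restrict-∈ X (δ x₀) i∈X))
                         (Σℚ-cong (λ l → cong (c (suc l) *_) (sym (restrict-∈ X (vs l) i∈X)))))
                       (proj₂ (proj₂ dependence) i)
    by-first-coefficient : Dec (c zero ≡ 0ℚ) → StarEigenvector G μ X x₀
    by-first-coefficient (yes c₀≡0) = ⊥-elim (trivial (proj₁ (proj₂ dependence)))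
      where
      w≡0 : ∀ i → w i ≡ 0ℚ
      w≡0 = not-eigenvalue w
        (λ i i∈X → trans (sym (trans (cong (λ a → a * δ x₀ i + w i) c₀≡0)
                                     (solve 2 (λ d w → con 0ℚ :* d :+ w := w) refl (δ x₀ i) (w i))))
                         (on-X i i∈X))
        (λ i _ → w-ker i)
      trivial : ¬ ∃ λ l → c l ≢ 0ℚ
      trivial (zero , c₀≢0) = c₀≢0 c₀≡0
      trivial (suc l , cl≢0) = cl≢0 (independent (λ l → c (suc l)) w≡0 l)
    by-first-coefficient (no c₀≢0) = record
      { vec = e ; in-ker = InKer-scale G μ (- 1/ c zero) w w-ker ; at-x₀ = e-at-x₀ ; off-x₀ = e-off-x₀ }
      where
      instance _ = ≢-nonZero c₀≢0
      e : Vecℚ (n G)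
      e j = (- 1/ c zero) * w j
      w≡-c₀δ : ∀ i → i ∈ X → w i ≡ - (c zero * δ x₀ i)
      w≡-c₀δ i i∈X = trans (solve 2 (λ a w → w := (a :+ w) :- a) refl (c zero * δ x₀ i) (w i))
                           (trans (cong (_- c zero * δ x₀ i) (on-X i i∈X)) (+-identityˡ _))
      e-at-x₀ : e x₀ ≡ 1ℚ
      e-at-x₀ = begin
        (- 1/ c zero) * w x₀                     ≡⟨ cong ((- 1/ c zero) *_) (w≡-c₀δ x₀ x₀∈X) ⟩
        (- 1/ c zero) * - (c zero * δ x₀ x₀)     ≡⟨ cong (λ z → (- 1/ c zero) * - (c zero * z)) (δ-diag x₀) ⟩
        (- 1/ c zero) * - (c zero * 1ℚ)          ≡⟨ solve 2 (λ i c → (:- i) :* (:- (c :* con 1ℚ)) := i :* c) refl (1/ c zero) (c zero) ⟩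
        1/ c zero * c zero                       ≡⟨ *-inverseˡ (c zero) ⟩
        1ℚ                                       ∎
        where open ≡-Reasoning
      e-off-x₀ : ∀ y → y ∈ X → y ≢ x₀ → e y ≡ 0ℚ
      e-off-x₀ y y∈X y≢x₀ = begin
        (- 1/ c zero) * w y                      ≡⟨ cong ((- 1/ c zero) *_) (w≡-c₀δ y y∈X) ⟩
        (- 1/ c zero) * - (c zero * δ x₀ y)      ≡⟨ cong (λ z → (- 1/ c zero) * - (c zero * z)) (δ-off y≢x₀) ⟩
        (- 1/ c zero) * - (c zero * 0ℚ)          ≡⟨ solve 2 (λ i c → (:- i) :* (:- (c :* con 0ℚ)) := con 0ℚ) refl (1/ c zero) (c zero) ⟩
        0ℚ                                       ∎
        where open ≡-Reasoning

  +≡0⇒≡- : ∀ x y z → x + y + z ≡ 0ℚ → z ≡ - x - y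
  +≡0⇒≡- x y z x+y+z≡0 = trans (solve 3 (λ x y z → z := (x :+ y :+ z) :- x :- y) refl x y z)
    (trans (cong (λ w → w - x - y) x+y+z≡0) (solve 2 (λ x y → con 0ℚ :- x :- y := :- x :- y) refl x y))

  Σ⊎ : ∀ {t s} → (Fin t ⊎ Fin s → ℚ) → ℚ
  Σ⊎ h = Σℚ (λ a → h (inj₁ a)) + Σℚ (λ b → h (inj₂ b))

  Σ⊎-cong : ∀ {t s} {g h : Fin t ⊎ Fin s → ℚ} → (∀ z → g z ≡ h z) → Σ⊎ g ≡ Σ⊎ h
  Σ⊎-cong g≗h = cong₂ _+_ (Σℚ-cong (λ a → g≗h (inj₁ a))) (Σℚ-cong (λ b → g≗h (inj₂ b)))

  Σ⊎-zero : ∀ {t s} (h : Fin t ⊎ Fin s → ℚ) → (∀ z → h z ≡ 0ℚ) → Σ⊎ h ≡ 0ℚ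
  Σ⊎-zero h h≗0 = trans (cong₂ _+_ (Σℚ-zero _ (λ a → h≗0 (inj₁ a))) (Σℚ-zero _ (λ b → h≗0 (inj₂ b)))) (+-identityʳ 0ℚ)

  Σ⊎-neg : ∀ {t s} (h : Fin t ⊎ Fin s → ℚ) → Σ⊎ (λ z → - h z) ≡ - Σ⊎ h
  Σ⊎-neg h = trans (cong₂ _+_ (Σℚ-neg (h ∘ inj₁)) (Σℚ-neg (h ∘ inj₂)))
    (solve 2 (λ a b → :- a :+ :- b := :- (a :+ b)) refl (Σℚ (h ∘ inj₁)) (Σℚ (h ∘ inj₂)))

  Σℚ-Σ⊎-comm : ∀ {m t s} (F : Fin m → Fin t ⊎ Fin s → ℚ) → Σℚ (λ j → Σ⊎ (F j)) ≡ Σ⊎ (λ z → Σℚ (λ j → F j z))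
  Σℚ-Σ⊎-comm F = trans (Σℚ-+ (λ j → Σℚ (λ a → F j (inj₁ a))) (λ j → Σℚ (λ b → F j (inj₂ b))))
    (cong₂ _+_ (Σℚ-comm (λ j a → F j (inj₁ a))) (Σℚ-comm (λ j b → F j (inj₂ b))))

  eq⊎ : ∀ {t s} → Fin t ⊎ Fin s → Fin t ⊎ Fin s → Bool
  eq⊎ (inj₁ a) (inj₁ a′) = eqᵇ a a′
  eq⊎ (inj₂ b) (inj₂ b′) = eqᵇ b b′
  eq⊎ _ _ = false

  Σ⊎-indicator : ∀ {t s} (z₀ : Fin t ⊎ Fin s) (h : Fin t ⊎ Fin s → ℚ) → Σ⊎ (λ z → 𝟙 (eq⊎ z z₀) * h z) ≡ h z₀
  Σ⊎-indicator (inj₁ a₀) h =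
    trans (cong₂ _+_ (Σℚ-indicator a₀ (h ∘ inj₁)) (Σℚ-zero _ (λ b → *-zeroˡ (h (inj₂ b))))) (+-identityʳ _)
  Σ⊎-indicator (inj₂ b₀) h =
    trans (cong₂ _+_ (Σℚ-zero _ (λ a → *-zeroˡ (h (inj₁ a)))) (Σℚ-indicator b₀ (h ∘ inj₂))) (+-identityˡ _)

  near : ∀ {t s} → Fin t ⊎ Fin s → Fin t ⊎ Fin s → Bool
  near z z′ = Kadj z z′ ∨ eq⊎ z z′

  eqᵇ-injective : ∀ {t s m} (f : Fin t ⊎ Fin s → Fin m) → (∀ z z' → f z ≡ f z' → z ≡ z') →
    ∀ z z' → eqᵇ (f z) (f z') ≡ eq⊎ z z'
  eqᵇ-injective f f-injective (inj₁ a) (inj₁ a′) = eqᵇ-resp-⇔ (λ e → inj₁-injective (f-injective _ _ e)) (cong (f ∘ inj₁))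
  eqᵇ-injective f f-injective (inj₂ b) (inj₂ b′) = eqᵇ-resp-⇔ (λ e → inj₂-injective (f-injective _ _ e)) (cong (f ∘ inj₂))
  eqᵇ-injective f f-injective (inj₁ a) (inj₂ b′) = eqᵇ-≢ (λ e → case f-injective _ _ e of λ ())
  eqᵇ-injective f f-injective (inj₂ b) (inj₁ a′) = eqᵇ-≢ (λ e → case f-injective _ _ e of λ ())

  eq⊎-refl : ∀ {t s} (z : Fin t ⊎ Fin s) → eq⊎ z z ≡ true
  eq⊎-refl (inj₁ a) = eqᵇ-refl a
  eq⊎-refl (inj₂ b) = eqᵇ-refl b

  eq⊎-sym : ∀ {t s} (z z′ : Fin t ⊎ Fin s) → eq⊎ z z′ ≡ eq⊎ z′ z
  eq⊎-sym (inj₁ a) (inj₁ a′) = eqᵇ-sym a a′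
  eq⊎-sym (inj₂ b) (inj₂ b′) = eqᵇ-sym b b′
  eq⊎-sym (inj₁ _) (inj₂ _) = refl
  eq⊎-sym (inj₂ _) (inj₁ _) = refl

  eq⊎⇒≡ : ∀ {t s} {z z′ : Fin t ⊎ Fin s} → eq⊎ z z′ ≡ true → z ≡ z′
  eq⊎⇒≡ {z = inj₁ a} {inj₁ a′} e = cong inj₁ (eqᵇ⇒≡ e)
  eq⊎⇒≡ {z = inj₂ b} {inj₂ b′} e = cong inj₂ (eqᵇ⇒≡ e)

  Kadj-irrefl : ∀ {t s} (z : Fin t ⊎ Fin s) → Kadj z z ≡ false
  Kadj-irrefl (inj₁ _) = refl
  Kadj-irrefl (inj₂ _) = refl

  near-sym : ∀ {t s} (z z′ : Fin t ⊎ Fin s) → near z z′ ≡ near z′ z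
  near-sym (inj₁ a) (inj₁ a′) = eqᵇ-sym a a′
  near-sym (inj₂ b) (inj₂ b′) = eqᵇ-sym b b′
  near-sym (inj₁ _) (inj₂ _) = refl
  near-sym (inj₂ _) (inj₁ _) = refl

  -- The vertex types of G(r): the vertices of K_{t,s} themselves, and the classes
  -- V_i, W_j of vertices behaving like v_i, w_j.
  data VType (t s : ℕ) : Set where
    vertex twin : Fin t ⊎ Fin s → VType t s

  type-adj : ∀ {t s} → VType t s → VType t s → Bool
  type-adj (vertex z) (vertex z′) = Kadj z z′
  type-adj (vertex z) (twin z′) = near z z′
  type-adj (twin z) (vertex z′) = near z z′
  type-adj (twin z) (twin z′) = near z z′

  eqType : ∀ {t s} → VType t s → VType t s → Bool
  eqType (vertex z) (vertex z′) = eq⊎ z z′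
  eqType (twin z) (twin z′) = eq⊎ z z′
  eqType (vertex _) (twin _) = false
  eqType (twin _) (vertex _) = false

  eqType-refl : ∀ {t s} (c : VType t s) → eqType c c ≡ true
  eqType-refl (vertex z) = eq⊎-refl z
  eqType-refl (twin z) = eq⊎-refl z

  eqType⇒≡ : ∀ {t s} {c c′ : VType t s} → eqType c c′ ≡ true → c ≡ c′
  eqType⇒≡ {c = vertex z} {vertex z′} e = cong vertex (eq⊎⇒≡ e)
  eqType⇒≡ {c = twin z} {twin z′} e = cong twin (eq⊎⇒≡ e)

  Σtype : ∀ {t s} → (VType t s → ℚ) → ℚ
  Σtype g = Σ⊎ (g ∘ vertex) + Σ⊎ (g ∘ twin)

  Σtype-indicator : ∀ {t s} (c₀ : VType t s) (g : VType t s → ℚ) → Σtype (λ c → 𝟙 (eqType c c₀) * g c) ≡ g c₀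
  Σtype-indicator (vertex z₀) g =
    trans (cong₂ _+_ (Σ⊎-indicator z₀ (g ∘ vertex)) (Σ⊎-zero _ (λ z → *-zeroˡ (g (twin z))))) (+-identityʳ _)
  Σtype-indicator (twin z₀) g =
    trans (cong₂ _+_ (Σ⊎-zero _ (λ z → *-zeroˡ (g (vertex z)))) (Σ⊎-indicator z₀ (g ∘ twin))) (+-identityˡ _)

  Σℚ-Σtype-comm : ∀ {m t s} (F : Fin m → VType t s → ℚ) → Σℚ (λ j → Σtype (F j)) ≡ Σtype (λ c → Σℚ (λ j → F j c))
  Σℚ-Σtype-comm F = trans (Σℚ-+ (λ j → Σ⊎ (F j ∘ vertex)) (λ j → Σ⊎ (F j ∘ twin)))
    (cong₂ _+_ (Σℚ-Σ⊎-comm (λ j → F j ∘ vertex)) (Σℚ-Σ⊎-comm (λ j → F j ∘ twin)))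

  GAdj-irrefl : ∀ {t s a b} (g : GV t s a b) → GAdj g g ≡ false
  GAdj-irrefl (gv _) = refl
  GAdj-irrefl (gw _) = refl
  GAdj-irrefl (gx i p) rewrite eqᵇ-refl i | eqᵇ-refl p = refl
  GAdj-irrefl (gy j q) rewrite eqᵇ-refl j | eqᵇ-refl q = refl

  eqᵇ≡eqᵇ∧not : ∀ {m k} (i i′ : Fin m) (p p′ : Fin k) → (i ≡ i′ → p ≢ p′) → eqᵇ i i′ ≡ (eqᵇ i i′ ∧ not (eqᵇ p p′))
  eqᵇ≡eqᵇ∧not i i′ p p′ p≢p′ with i Fin.≟ i′
  ... | no _ = refl
  ... | yes i≡i′ = sym (cong not (eqᵇ-≢ (p≢p′ i≡i′)))

  -- Eliminating p, q and W leaves (T + S - 2) V (1 + V) as a combination of the hypotheses.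
  row-sums-dichotomy : ∀ p q T S V W → T + S - 1ℚ - 1ℚ ≢ 0ℚ →
    1ℚ + V + W ≡ 0ℚ → p + T * W + V ≡ 0ℚ → q + S * V + W ≡ 0ℚ → (- p - p * W) + (- q - q * V) + 1ℚ ≡ 0ℚ →
    (V ≡ - 1ℚ × W ≡ 0ℚ × p ≡ 1ℚ × q ≡ S) ⊎ (V ≡ 0ℚ × W ≡ - 1ℚ × p ≡ T × q ≡ 1ℚ)
  row-sums-dichotomy p q T S V W T+S-2≢0 h₀ h₁ h₂ h₃ = by-cases (V ≟ 0ℚ)
    where
    open ≡-Reasoning
    W≡ : W ≡ - 1ℚ - V
    W≡ = begin
      W                         ≡⟨ solve 2 (λ V W → W := (con 1ℚ :+ V :+ W) :- con 1ℚ :- V) refl V W ⟩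
      (1ℚ + V + W) - 1ℚ - V     ≡⟨ cong (λ x → x - 1ℚ - V) h₀ ⟩
      0ℚ - 1ℚ - V               ≡⟨ solve 1 (λ V → con 0ℚ :- con 1ℚ :- V := :- con 1ℚ :- V) refl V ⟩
      - 1ℚ - V                  ∎
    p≡ : p ≡ T + (T - 1ℚ) * V
    p≡ = begin
      p                                        ≡⟨ solve 4 (λ p T V W → p := (p :+ T :* W :+ V) :- T :* W :- V) refl p T V W ⟩
      (p + T * W + V) - T * W - V              ≡⟨ cong₂ (λ x y → x - T * y - V) h₁ W≡ ⟩
      0ℚ - T * (- 1ℚ - V) - V                  ≡⟨ solve 2 (λ T V → con 0ℚ :- T :* (:- con 1ℚ :- V) :- V := T :+ (T :- con 1ℚ) :* V) refl T V ⟩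
      T + (T - 1ℚ) * V                         ∎
    q≡ : q ≡ 1ℚ - (S - 1ℚ) * V
    q≡ = begin
      q                                        ≡⟨ solve 4 (λ q S V W → q := (q :+ S :* V :+ W) :- S :* V :- W) refl q S V W ⟩
      (q + S * V + W) - S * V - W              ≡⟨ cong₂ (λ x y → x - S * V - y) h₂ W≡ ⟩
      0ℚ - S * V - (- 1ℚ - V)                  ≡⟨ solve 2 (λ S V → con 0ℚ :- S :* V :- (:- con 1ℚ :- V) := con 1ℚ :- (S :- con 1ℚ) :* V) refl S V ⟩
      1ℚ - (S - 1ℚ) * V                        ∎
    product≡0 : (T + S - 1ℚ - 1ℚ) * (V * (1ℚ + V)) ≡ 0ℚ
    product≡0 = begin
      (T + S - 1ℚ - 1ℚ) * (V * (1ℚ + V))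
        ≡⟨ solve 3 (λ T S V → (T :+ S :- con 1ℚ :- con 1ℚ) :* (V :* (con 1ℚ :+ V))
             := (:- (T :+ (T :- con 1ℚ) :* V) :- (T :+ (T :- con 1ℚ) :* V) :* (:- con 1ℚ :- V))
                :+ (:- (con 1ℚ :- (S :- con 1ℚ) :* V) :- (con 1ℚ :- (S :- con 1ℚ) :* V) :* V) :+ con 1ℚ) refl T S V ⟩
      (- (T + (T - 1ℚ) * V) - (T + (T - 1ℚ) * V) * (- 1ℚ - V)) + (- (1ℚ - (S - 1ℚ) * V) - (1ℚ - (S - 1ℚ) * V) * V) + 1ℚ
        ≡⟨ cong₂ (λ x y → (- x - x * (- 1ℚ - V)) + (- y - y * V) + 1ℚ) (sym p≡) (sym q≡) ⟩
      (- p - p * (- 1ℚ - V)) + (- q - q * V) + 1ℚ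
        ≡⟨ cong (λ w → (- p - p * w) + (- q - q * V) + 1ℚ) (sym W≡) ⟩
      (- p - p * W) + (- q - q * V) + 1ℚ
        ≡⟨ h₃ ⟩
      0ℚ ∎
    by-cases : Dec (V ≡ 0ℚ) → (V ≡ - 1ℚ × W ≡ 0ℚ × p ≡ 1ℚ × q ≡ S) ⊎ (V ≡ 0ℚ × W ≡ - 1ℚ × p ≡ T × q ≡ 1ℚ)
    by-cases (yes V≡0) = inj₂ (V≡0
      , trans W≡ (trans (cong (λ v → - 1ℚ - v) V≡0) (solve 0 (:- con 1ℚ :- con 0ℚ := :- con 1ℚ) refl))
      , trans p≡ (trans (cong (λ v → T + (T - 1ℚ) * v) V≡0) (solve 1 (λ T → T :+ (T :- con 1ℚ) :* con 0ℚ := T) refl T))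
      , trans q≡ (trans (cong (λ v → 1ℚ - (S - 1ℚ) * v) V≡0) (solve 1 (λ S → con 1ℚ :- (S :- con 1ℚ) :* con 0ℚ := con 1ℚ) refl S)))
    by-cases (no V≢0) = inj₁ (V≡-1
      , trans W≡ (trans (cong (λ v → - 1ℚ - v) V≡-1) (solve 0 (:- con 1ℚ :- (:- con 1ℚ) := con 0ℚ) refl))
      , trans p≡ (trans (cong (λ v → T + (T - 1ℚ) * v) V≡-1) (solve 1 (λ T → T :+ (T :- con 1ℚ) :* (:- con 1ℚ) := con 1ℚ) refl T))
      , trans q≡ (trans (cong (λ v → 1ℚ - (S - 1ℚ) * v) V≡-1) (solve 1 (λ S → con 1ℚ :- (S :- con 1ℚ) :* (:- con 1ℚ) := S) refl S)))
      where
      1+V≡0 : 1ℚ + V ≡ 0ℚ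
      1+V≡0 = *≡0⇒≡0 V (1ℚ + V) V≢0 (*≡0⇒≡0 _ _ T+S-2≢0 product≡0)
      V≡-1 : V ≡ - 1ℚ
      V≡-1 = trans (solve 1 (λ V → V := (con 1ℚ :+ V) :- con 1ℚ) refl V)
                   (trans (cong (_- 1ℚ) 1+V≡0) (solve 0 (con 0ℚ :- con 1ℚ := :- con 1ℚ) refl))

  module StarComplement {t s r : ℕ} (G : Graph) (regular : Regular G r) (X : Subset (n G))
                        (H : DeletedIsoK G X t s) where

    N : ℕ
    N = n G

    f : Fin t ⊎ Fin s → Fin N
    f = proj₁ H

    f-injective : ∀ z z' → f z ≡ f z' → z ≡ z'
    f-injective = proj₁ (proj₂ H)

    f∉X : ∀ z → f z ∉ X
    f∉X = proj₁ (proj₂ (proj₂ H))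

    f-onto : ∀ j → j ∉ X → ∃ λ z → f z ≡ j
    f-onto = proj₁ (proj₂ (proj₂ (proj₂ H)))

    f-adj : ∀ z z' → adj G (f z) (f z') ≡ Kadj z z'
    f-adj = proj₂ (proj₂ (proj₂ (proj₂ H)))

    Σℚ-outside-X : (g : Fin N → ℚ) → (∀ j → j ∈ X → g j ≡ 0ℚ) → Σℚ g ≡ Σ⊎ (g ∘ f)
    Σℚ-outside-X g g≡0-on-X = begin
      Σℚ g                                          ≡⟨ Σℚ-cong split ⟩
      Σℚ (λ j → Σ⊎ (λ z → 𝟙 (eqᵇ j (f z)) * g j))   ≡⟨ Σℚ-Σ⊎-comm (λ j z → 𝟙 (eqᵇ j (f z)) * g j) ⟩
      Σ⊎ (λ z → Σℚ (λ j → 𝟙 (eqᵇ j (f z)) * g j))   ≡⟨ Σ⊎-cong (λ z → Σℚ-indicator (f z) g) ⟩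
      Σ⊎ (g ∘ f)                                    ∎
      where
      open ≡-Reasoning
      split : ∀ j → g j ≡ Σ⊎ (λ z → 𝟙 (eqᵇ j (f z)) * g j)
      split j with j ∈? X
      ... | yes j∈X = trans (g≡0-on-X j j∈X)
        (sym (Σ⊎-zero _ (λ z → trans (cong (𝟙 (eqᵇ j (f z)) *_) (g≡0-on-X j j∈X)) (*-zeroʳ (𝟙 (eqᵇ j (f z)))))))
      ... | no j∉X with f-onto j j∉X
      ...   | z₀ , refl = sym (trans (Σ⊎-cong (λ z → cong (λ b → 𝟙 b * g (f z₀))
                                       (trans (eqᵇ-sym (f z₀) (f z)) (eqᵇ-injective f f-injective z z₀))))
                                     (Σ⊎-indicator z₀ (λ _ → g (f z₀))))

    Σℚ-split-X : (g : Fin N → ℚ) → Σℚ g ≡ Σℚ (restrict X g) + Σ⊎ (g ∘ f)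
    Σℚ-split-X g = begin
      Σℚ g                                                    ≡⟨ Σℚ-cong (λ j → solve 2 (λ a b → a := b :+ (a :- b)) refl (g j) (restrict X g j)) ⟩
      Σℚ (λ j → restrict X g j + (g j - restrict X g j))      ≡⟨ Σℚ-+ (restrict X g) (λ j → g j - restrict X g j) ⟩
      Σℚ (restrict X g) + Σℚ (λ j → g j - restrict X g j)     ≡⟨ cong (Σℚ (restrict X g) +_) (Σℚ-outside-X _ outside-part) ⟩
      Σℚ (restrict X g) + Σ⊎ (λ z → g (f z) - restrict X g (f z))
        ≡⟨ cong (Σℚ (restrict X g) +_) (Σ⊎-cong (λ z → trans (cong (λ c → g (f z) - c) (restrict-supported X g (f z) (f∉X z)))
                                                              (solve 1 (λ a → a :- con 0ℚ := a) refl (g (f z))))) ⟩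
      Σℚ (restrict X g) + Σ⊎ (g ∘ f)                          ∎
      where
      open ≡-Reasoning
      outside-part : ∀ j → j ∈ X → g j - restrict X g j ≡ 0ℚ
      outside-part j j∈X = trans (cong (λ c → g j - c) (restrict-∈ X g j∈X)) (solve 1 (λ a → a :- a := con 0ℚ) refl (g j))

    row-sum : ∀ j → Σℚ (A G j) ≡ toℚ r
    row-sum j = trans (sym (toℚ-count (adj G j))) (cong toℚ (trans (sym (degree≡count G j)) (regular j)))

    -- r ≠ -1, so a (-1)-eigenvector is orthogonal to the all-ones eigenvector.
    Σℚ-eigenvector : ∀ e → InKer G (- 1ℚ) e → Σℚ e ≡ 0ℚ
    Σℚ-eigenvector e ker = *≡0⇒≡0 (toℚ (suc r)) (Σℚ e) (toℚ-suc≢0 r) (begin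
      toℚ (suc r) * Σℚ e                             ≡⟨ solve 2 (λ r s → (con 1ℚ :+ r) :* s := r :* s :+ s) refl (toℚ r) (Σℚ e) ⟩
      toℚ r * Σℚ e + Σℚ e                            ≡⟨ cong (_+ Σℚ e) (sym (*-Σℚ (toℚ r) e)) ⟩
      Σℚ (λ j → toℚ r * e j) + Σℚ e                  ≡⟨ cong (_+ Σℚ e) (Σℚ-cong (λ j → cong (_* e j) (sym column-sum))) ⟩
      Σℚ (λ j → Σℚ (λ i → A G i j) * e j) + Σℚ e     ≡⟨ cong (_+ Σℚ e) (Σℚ-cong (λ j → sym (Σℚ-* (e j) (λ i → A G i j)))) ⟩
      Σℚ (λ j → Σℚ (λ i → A G i j * e j)) + Σℚ e     ≡⟨ cong (_+ Σℚ e) (sym (Σℚ-comm (λ i j → A G i j * e j))) ⟩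
      Σℚ (λ i → Σℚ (λ j → A G i j * e j)) + Σℚ e     ≡⟨ cong (_+ Σℚ e) (trans (Σℚ-cong row) (Σℚ-neg e)) ⟩
      - Σℚ e + Σℚ e                                  ≡⟨ solve 1 (λ a → :- a :+ a := con 0ℚ) refl (Σℚ e) ⟩
      0ℚ                                             ∎)
      where
      open ≡-Reasoning
      column-sum : ∀ {j} → Σℚ (λ i → A G i j) ≡ toℚ r
      column-sum {j} = trans (Σℚ-cong (λ i → cong 𝟙 (adj-sym G i j))) (row-sum j)
      row : ∀ i → Σℚ (λ j → A G i j * e j) ≡ - e i
      row i = trans (solve 2 (λ a b → a := (a :- (:- con 1ℚ) :* b) :- b) refl (Σℚ (λ j → A G i j * e j)) (e i))
                    (trans (cong (_- e i) (ker i)) (+-identityˡ _))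

    record Twin (x : Fin N) : Set where
      field
        partner : Fin t ⊎ Fin s
        adj-H : ∀ z → adj G (f z) x ≡ near z partner
        adj-X : ∀ y → y ∈ X → y ≢ x → adj G y x ≡ adj G y (f partner)

    module Eigenvector {x₀} (x₀∈X : x₀ ∈ X) (E : StarEigenvector G (- 1ℚ) X x₀) where

      open StarEigenvector E renaming (vec to e)

      u : Fin t ⊎ Fin s → ℚ
      u = e ∘ f

      e-on-X : ∀ j → j ∈ X → e j ≡ δ x₀ j
      e-on-X j j∈X with j Fin.≟ x₀
      ... | yes refl = at-x₀
      ... | no j≢x₀ = off-x₀ j j∈X j≢x₀

      restrict-against-e : ∀ (c : Fin N → ℚ) j → restrict X (λ j → c j * e j) j ≡ 𝟙 (eqᵇ j x₀) * c j
      restrict-against-e c j with j ∈? X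
      ... | yes j∈X = trans (cong (c j *_) (e-on-X j j∈X)) (solve 2 (λ c d → c :* d := d :* c) refl (c j) (δ x₀ j))
      ... | no j∉X = sym (trans (cong (λ b → 𝟙 b * c j) (eqᵇ-≢ {a = j} {b = x₀} λ { refl → j∉X x₀∈X })) (*-zeroˡ (c j)))

      Σℚ-against-e : ∀ (c : Fin N → ℚ) → Σℚ (λ j → c j * e j) ≡ c x₀ + Σ⊎ (λ z → c (f z) * u z)
      Σℚ-against-e c = trans (Σℚ-split-X (λ j → c j * e j))
        (cong (_+ Σ⊎ (λ z → c (f z) * u z)) (trans (Σℚ-cong (restrict-against-e c)) (Σℚ-indicator x₀ c)))

      row : ∀ i → A G i x₀ + Σ⊎ (λ z → A G i (f z) * u z) + e i ≡ 0ℚ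
      row i = trans (cong (_+ e i) (sym (Σℚ-against-e (A G i))))
        (trans (solve 2 (λ a b → a :+ b := a :- (:- con 1ℚ) :* b) refl (Σℚ (λ j → A G i j * e j)) (e i)) (in-ker i))

      V W : ℚ
      V = Σℚ (u ∘ inj₁)
      W = Σℚ (u ∘ inj₂)

      β : Fin t → Bool
      β a = adj G (f (inj₁ a)) x₀

      γ : Fin s → Bool
      γ b = adj G (f (inj₂ b)) x₀

      p q : ℚ
      p = Σℚ (𝟙 ∘ β)
      q = Σℚ (𝟙 ∘ γ)

      row-V : ∀ a → 𝟙 (β a) + W + u (inj₁ a) ≡ 0ℚ
      row-V a = trans (cong (λ x → 𝟙 (β a) + x + u (inj₁ a)) (sym H-part)) (row (f (inj₁ a)))
        where
        H-part : Σ⊎ (λ z → A G (f (inj₁ a)) (f z) * u z) ≡ W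
        H-part = trans (cong₂ _+_ (Σℚ-zero _ (λ a′ → trans (cong (λ b → 𝟙 b * u (inj₁ a′)) (f-adj (inj₁ a) (inj₁ a′))) (*-zeroˡ (u (inj₁ a′)))))
                                  (Σℚ-cong (λ b → trans (cong (λ c → 𝟙 c * u (inj₂ b)) (f-adj (inj₁ a) (inj₂ b))) (*-identityˡ _))))
                       (+-identityˡ W)

      row-W : ∀ b → 𝟙 (γ b) + V + u (inj₂ b) ≡ 0ℚ
      row-W b = trans (cong (λ x → 𝟙 (γ b) + x + u (inj₂ b)) (sym H-part)) (row (f (inj₂ b)))
        where
        H-part : Σ⊎ (λ z → A G (f (inj₂ b)) (f z) * u z) ≡ V
        H-part = trans (cong₂ _+_ (Σℚ-cong (λ a → trans (cong (λ c → 𝟙 c * u (inj₁ a)) (f-adj (inj₂ b) (inj₁ a))) (*-identityˡ _)))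
                                  (Σℚ-zero _ (λ b′ → trans (cong (λ c → 𝟙 c * u (inj₂ b′)) (f-adj (inj₂ b) (inj₂ b′))) (*-zeroˡ (u (inj₂ b′))))))
                       (+-identityʳ V)

      row-x₀ : Σℚ (λ a → 𝟙 (β a) * u (inj₁ a)) + Σℚ (λ b → 𝟙 (γ b) * u (inj₂ b)) + 1ℚ ≡ 0ℚ
      row-x₀ = trans (cong₂ _+_ (sym H-part) (sym at-x₀)) (row x₀)
        where
        H-part : A G x₀ x₀ + Σ⊎ (λ z → A G x₀ (f z) * u z) ≡ Σℚ (λ a → 𝟙 (β a) * u (inj₁ a)) + Σℚ (λ b → 𝟙 (γ b) * u (inj₂ b))
        H-part = trans (cong₂ _+_ (cong 𝟙 (irrefl G x₀)) (Σ⊎-cong (λ z → cong (λ c → 𝟙 c * u z) (adj-sym G x₀ (f z)))))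
                       (+-identityˡ _)

      sum-e : 1ℚ + V + W ≡ 0ℚ
      sum-e = begin
        1ℚ + V + W                              ≡⟨ solve 3 (λ a b c → a :+ b :+ c := a :+ (b :+ c)) refl 1ℚ V W ⟩
        1ℚ + Σ⊎ u                               ≡⟨ cong (1ℚ +_) (Σ⊎-cong (λ z → sym (*-identityˡ (u z)))) ⟩
        1ℚ + Σ⊎ (λ z → 1ℚ * u z)                ≡⟨ sym (Σℚ-against-e (λ _ → 1ℚ)) ⟩
        Σℚ (λ j → 1ℚ * e j)                     ≡⟨ trans (Σℚ-cong (λ j → *-identityˡ (e j))) (Σℚ-eigenvector e in-ker) ⟩
        0ℚ                                      ∎
        where open ≡-Reasoning

      sum-row-V : p + toℚ t * W + V ≡ 0ℚ
      sum-row-V = trans (sym (trans (Σℚ-+ (λ a → 𝟙 (β a) + W) (u ∘ inj₁)) (cong (_+ V) (trans (Σℚ-+ (𝟙 ∘ β) (λ _ → W))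
                                     (cong (p +_) (Σℚ-const {t} W))))))
                        (Σℚ-zero _ row-V)

      sum-row-W : q + toℚ s * V + W ≡ 0ℚ
      sum-row-W = trans (sym (trans (Σℚ-+ (λ b → 𝟙 (γ b) + V) (u ∘ inj₂)) (cong (_+ W) (trans (Σℚ-+ (𝟙 ∘ γ) (λ _ → V))
                                     (cong (q +_) (Σℚ-const {s} V))))))
                        (Σℚ-zero _ row-W)

      Σℚ-𝟙-weighted : ∀ {m} (P : Fin m → Bool) (c : ℚ) (w : Fin m → ℚ) → (∀ a → w a ≡ - 𝟙 (P a) - c) →
        Σℚ (λ a → 𝟙 (P a) * w a) ≡ - Σℚ (𝟙 ∘ P) - Σℚ (𝟙 ∘ P) * c
      Σℚ-𝟙-weighted P c w w≡ = begin
        Σℚ (λ a → 𝟙 (P a) * w a)            ≡⟨ Σℚ-cong (λ a → trans (cong (𝟙 (P a) *_) (w≡ a))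
             (trans (solve 2 (λ b c → b :* (:- b :- c) := :- (b :* b) :- b :* c) refl (𝟙 (P a)) c)
                    (cong (λ x → - x - 𝟙 (P a) * c) (𝟙-idem (P a))))) ⟩
        Σℚ (λ a → - 𝟙 (P a) - 𝟙 (P a) * c)  ≡⟨ trans (Σℚ-- (λ a → - 𝟙 (P a)) (λ a → 𝟙 (P a) * c)) (cong₂ _-_ (Σℚ-neg (𝟙 ∘ P)) (Σℚ-* c (𝟙 ∘ P))) ⟩
        - Σℚ (𝟙 ∘ P) - Σℚ (𝟙 ∘ P) * c       ∎
        where open ≡-Reasoning

      u-V : ∀ a → u (inj₁ a) ≡ - 𝟙 (β a) - W
      u-V a = +≡0⇒≡- (𝟙 (β a)) W (u (inj₁ a)) (row-V a)

      u-W : ∀ b → u (inj₂ b) ≡ - 𝟙 (γ b) - V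
      u-W b = +≡0⇒≡- (𝟙 (γ b)) V (u (inj₂ b)) (row-W b)

      row-x₀′ : (- p - p * W) + (- q - q * V) + 1ℚ ≡ 0ℚ
      row-x₀′ = trans (cong (_+ 1ℚ) (sym (cong₂ _+_ (Σℚ-𝟙-weighted β W (u ∘ inj₁) u-V) (Σℚ-𝟙-weighted γ V (u ∘ inj₂) u-W)))) row-x₀

      same-X-neighbours : ∀ z₀ → (∀ z → u z ≡ - 𝟙 (eq⊎ z z₀)) → ∀ y → y ∈ X → y ≢ x₀ → adj G y x₀ ≡ adj G y (f z₀)
      same-X-neighbours z₀ u≡ y y∈X y≢x₀ = 𝟙-injective (begin
        A G y x₀                                          ≡⟨ inverseˡ-unique _ _ row-y ⟩
        - Σ⊎ (λ z → A G y (f z) * u z)                    ≡⟨ cong -_ (Σ⊎-cong (λ z → trans (cong (A G y (f z) *_) (u≡ z))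
                                                               (solve 2 (λ a b → a :* (:- b) := :- (b :* a)) refl (A G y (f z)) (𝟙 (eq⊎ z z₀))))) ⟩
        - Σ⊎ (λ z → - (𝟙 (eq⊎ z z₀) * A G y (f z)))       ≡⟨ cong -_ (trans (Σ⊎-neg (λ z → 𝟙 (eq⊎ z z₀) * A G y (f z))) (cong -_ (Σ⊎-indicator z₀ (A G y ∘ f)))) ⟩
        - - A G y (f z₀)                                  ≡⟨ solve 1 (λ a → :- :- a := a) refl (A G y (f z₀)) ⟩
        A G y (f z₀)                                      ∎)
        where
        open ≡-Reasoning
        row-y : A G y x₀ + Σ⊎ (λ z → A G y (f z) * u z) ≡ 0ℚ
        row-y = trans (sym (trans (cong (A G y x₀ + Σ⊎ (λ z → A G y (f z) * u z) +_) (off-x₀ y y∈X y≢x₀)) (+-identityʳ _))) (row y)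

      twin-V : V ≡ - 1ℚ × W ≡ 0ℚ × p ≡ 1ℚ × q ≡ toℚ s → Twin x₀
      twin-V (V≡-1 , W≡0 , p≡1 , q≡s) = record
        { partner = inj₁ a₀ ; adj-H = λ { (inj₁ a) → β≡ a ; (inj₂ b) → γ≡true b } ; adj-X = same-X-neighbours (inj₁ a₀) u≡ }
        where
        β-unique : Σ (Fin t) λ a₀ → ∀ a → β a ≡ eqᵇ a a₀
        β-unique = count≡1⇒unique β (toℚ-injective (trans (toℚ-count β) (trans p≡1 (sym toℚ-1))))
        a₀ : Fin t
        a₀ = proj₁ β-unique
        β≡ : ∀ a → β a ≡ eqᵇ a a₀
        β≡ = proj₂ β-unique
        γ≡true : ∀ b → γ b ≡ true
        γ≡true = count≡m⇒all γ (toℚ-injective (trans (toℚ-count γ) q≡s))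
        u≡ : ∀ z → u z ≡ - 𝟙 (eq⊎ z (inj₁ a₀))
        u≡ (inj₁ a) = trans (u-V a) (trans (cong₂ (λ b w → - 𝟙 b - w) (β≡ a) W≡0) (solve 1 (λ x → :- x :- con 0ℚ := :- x) refl _))
        u≡ (inj₂ b) = trans (u-W b) (cong₂ (λ c v → - 𝟙 c - v) (γ≡true b) V≡-1)

      twin-W : V ≡ 0ℚ × W ≡ - 1ℚ × p ≡ toℚ t × q ≡ 1ℚ → Twin x₀
      twin-W (V≡0 , W≡-1 , p≡t , q≡1) = record
        { partner = inj₂ b₀ ; adj-H = λ { (inj₁ a) → β≡true a ; (inj₂ b) → γ≡ b } ; adj-X = same-X-neighbours (inj₂ b₀) u≡ }
        where
        γ-unique : Σ (Fin s) λ b₀ → ∀ b → γ b ≡ eqᵇ b b₀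
        γ-unique = count≡1⇒unique γ (toℚ-injective (trans (toℚ-count γ) (trans q≡1 (sym toℚ-1))))
        b₀ : Fin s
        b₀ = proj₁ γ-unique
        γ≡ : ∀ b → γ b ≡ eqᵇ b b₀
        γ≡ = proj₂ γ-unique
        β≡true : ∀ a → β a ≡ true
        β≡true = count≡m⇒all β (toℚ-injective (trans (toℚ-count β) p≡t))
        u≡ : ∀ z → u z ≡ - 𝟙 (eq⊎ z (inj₂ b₀))
        u≡ (inj₁ a) = trans (u-V a) (cong₂ (λ b w → - 𝟙 b - w) (β≡true a) W≡-1)
        u≡ (inj₂ b) = trans (u-W b) (trans (cong₂ (λ c v → - 𝟙 c - v) (γ≡ b) V≡0) (solve 1 (λ x → :- x :- con 0ℚ := :- x) refl _))

      classify : 2 ℕ.≤ t → 1 ℕ.≤ s → Twin x₀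
      classify 2≤t 1≤s = [ twin-V , twin-W ]′
        (row-sums-dichotomy p q (toℚ t) (toℚ s) V W (toℚ-t+s-2≢0 2≤t 1≤s) sum-e sum-row-V sum-row-W row-x₀′)

    module Types (twins : ∀ x → x ∈ X → Twin x) where

      data Located (j : Fin N) : Set where
        at-H : ∀ z → f z ≡ j → Located j
        at-X : j ∈ X → Located j

      locate : ∀ j → Located j
      locate j with j ∈? X
      ... | yes j∈X = at-X j∈X
      ... | no j∉X = at-H (proj₁ (f-onto j j∉X)) (proj₂ (f-onto j j∉X))

      partner-of : ∀ x → x ∈ X → Fin t ⊎ Fin s
      partner-of x x∈X = Twin.partner (twins x x∈X)

      type-at : ∀ {j} → Located j → VType t s
      type-at (at-H z _) = vertex z
      type-at {j} (at-X j∈X) = twin (partner-of j j∈X)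

      type-of : Fin N → VType t s
      type-of j = type-at (locate j)

      adj-located : ∀ {i j} (li : Located i) (lj : Located j) → i ≢ j → adj G i j ≡ type-adj (type-at li) (type-at lj)
      adj-located (at-H z refl) (at-H z′ refl) _ = f-adj z z′
      adj-located (at-H z refl) (at-X j∈X) _ = Twin.adj-H (twins _ j∈X) z
      adj-located {i} (at-X i∈X) (at-H z refl) _ =
        trans (adj-sym G i (f z)) (trans (Twin.adj-H (twins i i∈X) z) (near-sym z (partner-of i i∈X)))
      adj-located {i} {j} (at-X i∈X) (at-X j∈X) i≢j = begin
        adj G i j                                ≡⟨ Twin.adj-X (twins j j∈X) i i∈X i≢j ⟩
        adj G i (f (partner-of j j∈X))           ≡⟨ adj-sym G i _ ⟩
        adj G (f (partner-of j j∈X)) i           ≡⟨ Twin.adj-H (twins i i∈X) _ ⟩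
        near (partner-of j j∈X) (partner-of i i∈X) ≡⟨ near-sym (partner-of j j∈X) (partner-of i i∈X) ⟩
        near (partner-of i i∈X) (partner-of j j∈X) ∎
        where open ≡-Reasoning

      adj≡type-adj : ∀ i j → i ≢ j → adj G i j ≡ type-adj (type-of i) (type-of j)
      adj≡type-adj i j = adj-located (locate i) (locate j)

      type-of-f : ∀ z → type-of (f z) ≡ vertex z
      type-of-f z with locate (f z)
      ... | at-H z′ fz′≡fz = cong vertex (f-injective z′ z fz′≡fz)
      ... | at-X fz∈X = ⊥-elim (f∉X z fz∈X)

      type-of-X : ∀ j → j ∈ X → ∃ λ z → type-of j ≡ twin z
      type-of-X j j∈X with locate j
      ... | at-H z refl = ⊥-elim (f∉X z j∈X)
      ... | at-X j∈X′ = partner-of j j∈X′ , refl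

      type-vertex⇒f : ∀ j z → type-of j ≡ vertex z → j ≡ f z
      type-vertex⇒f j z e with locate j
      type-vertex⇒f j z refl | at-H .z fz≡j = sym fz≡j

      in-class : VType t s → Fin N → Bool
      in-class c j = eqType c (type-of j)

      size : VType t s → ℚ
      size c = Σℚ (𝟙 ∘ in-class c)

      Σℚ-by-type : ∀ (h : VType t s → ℚ) → Σℚ (h ∘ type-of) ≡ Σtype (λ c → h c * size c)
      Σℚ-by-type h = begin
        Σℚ (h ∘ type-of)                                      ≡⟨ Σℚ-cong (λ j → sym (Σtype-indicator (type-of j) h)) ⟩
        Σℚ (λ j → Σtype (λ c → 𝟙 (eqType c (type-of j)) * h c)) ≡⟨ Σℚ-Σtype-comm (λ j c → 𝟙 (eqType c (type-of j)) * h c) ⟩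
        Σtype (λ c → Σℚ (λ j → 𝟙 (in-class c j) * h c))        ≡⟨ Σ⊎-cong-type (λ c → trans (Σℚ-* (h c) (𝟙 ∘ in-class c))
                                                                     (solve 2 (λ a b → a :* b := b :* a) refl (size c) (h c))) ⟩
        Σtype (λ c → h c * size c)                            ∎
        where
        open ≡-Reasoning
        Σ⊎-cong-type : ∀ {g g′ : VType t s → ℚ} → (∀ c → g c ≡ g′ c) → Σtype g ≡ Σtype g′
        Σ⊎-cong-type g≗g′ = cong₂ _+_ (Σ⊎-cong (g≗g′ ∘ vertex)) (Σ⊎-cong (g≗g′ ∘ twin))

      size-vertex : ∀ z → size (vertex z) ≡ 1ℚ
      size-vertex z = begin
        size (vertex z)                                  ≡⟨ Σℚ-outside-X (𝟙 ∘ in-class (vertex z)) not-in-X ⟩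
        Σ⊎ (λ z′ → 𝟙 (eqType (vertex z) (type-of (f z′))))  ≡⟨ Σ⊎-cong (λ z′ → cong (𝟙 ∘ eqType (vertex z)) (type-of-f z′)) ⟩
        Σ⊎ (λ z′ → 𝟙 (eq⊎ z z′))                          ≡⟨ Σ⊎-cong (λ z′ → trans (cong 𝟙 (eq⊎-sym z z′)) (sym (*-identityʳ _))) ⟩
        Σ⊎ (λ z′ → 𝟙 (eq⊎ z′ z) * 1ℚ)                     ≡⟨ Σ⊎-indicator z (λ _ → 1ℚ) ⟩
        1ℚ                                               ∎
        where
        open ≡-Reasoning
        not-in-X : ∀ j → j ∈ X → 𝟙 (in-class (vertex z) j) ≡ 0ℚ
        not-in-X j j∈X with type-of-X j j∈X
        ... | z′ , e = cong (𝟙 ∘ eqType (vertex z)) e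

      class-size : Fin t ⊎ Fin s → ℕ
      class-size z = count (in-class (twin z))

      toℚ-class-size : ∀ z → toℚ (class-size z) ≡ size (twin z)
      toℚ-class-size z = toℚ-count (in-class (twin z))

      row-by-type : ∀ z → toℚ r ≡ Σtype (λ c → 𝟙 (type-adj (vertex z) c) * size c)
      row-by-type z = trans (sym (row-sum (f z))) (trans (Σℚ-cong A≡) (Σℚ-by-type (𝟙 ∘ type-adj (vertex z))))
        where
        A≡ : ∀ j → A G (f z) j ≡ 𝟙 (type-adj (vertex z) (type-of j))
        A≡ j with f z Fin.≟ j
        ... | no fz≢j = cong 𝟙 (trans (adj≡type-adj (f z) j fz≢j) (cong (λ c → type-adj c (type-of j)) (type-of-f z)))
        ... | yes refl = cong 𝟙 (trans (irrefl G (f z)) (sym (trans (cong (λ c → type-adj (vertex z) c) (type-of-f z)) (Kadj-irrefl z))))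

      degree-formula : ∀ z → toℚ r ≡ Σ⊎ (λ z′ → 𝟙 (Kadj z z′)) + Σ⊎ (λ z′ → 𝟙 (near z z′) * size (twin z′))
      degree-formula z = trans (row-by-type z)
        (cong (_+ Σ⊎ (λ z′ → 𝟙 (near z z′) * size (twin z′)))
              (Σ⊎-cong {g = λ z′ → 𝟙 (Kadj z z′) * size (vertex z′)} {h = λ z′ → 𝟙 (Kadj z z′)}
                (λ z′ → trans (cong (𝟙 (Kadj z z′) *_) (size-vertex z′)) (*-identityʳ _))))

      toℚ-Σ-class-sizes : ∀ {m} (g : Fin m → Fin t ⊎ Fin s) → toℚ (Σℕ (class-size ∘ g)) ≡ Σℚ (λ l → 1ℚ * size (twin (g l)))
      toℚ-Σ-class-sizes g = trans (toℚ-Σℕ (class-size ∘ g))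
        (Σℚ-cong (λ l → trans (toℚ-class-size (g l)) (sym (*-identityˡ _))))

      degree-V : ∀ a → r ≡ s ℕ.+ class-size (inj₁ a) ℕ.+ Σℕ (class-size ∘ inj₂)
      degree-V a = toℚ-injective (begin
        toℚ r
          ≡⟨ degree-formula (inj₁ a) ⟩
        (Σℚ {t} (λ _ → 0ℚ) + Σℚ {s} (λ _ → 1ℚ))
          + (Σℚ (λ a′ → 𝟙 (eqᵇ a a′) * size (twin (inj₁ a′))) + Σℚ (λ b → 1ℚ * size (twin (inj₂ b))))
          ≡⟨ cong₂ _+_ (cong₂ _+_ (Σℚ-0 {t}) (trans (Σℚ-const {s} 1ℚ) (*-identityʳ (toℚ s))))
                       (cong₂ _+_ (trans (Σℚ-indicatorˡ a (λ a′ → size (twin (inj₁ a′)))) (sym (toℚ-class-size (inj₁ a))))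
                                  (sym (toℚ-Σ-class-sizes inj₂))) ⟩
        (0ℚ + toℚ s) + (toℚ (class-size (inj₁ a)) + toℚ (Σℕ (class-size ∘ inj₂)))
          ≡⟨ solve 3 (λ x y z → (con 0ℚ :+ x) :+ (y :+ z) := x :+ y :+ z) refl (toℚ s) _ _ ⟩
        toℚ s + toℚ (class-size (inj₁ a)) + toℚ (Σℕ (class-size ∘ inj₂))
          ≡⟨ sym (trans (toℚ-+ (s ℕ.+ class-size (inj₁ a)) _) (cong (_+ _) (toℚ-+ s _))) ⟩
        toℚ (s ℕ.+ class-size (inj₁ a) ℕ.+ Σℕ (class-size ∘ inj₂)) ∎)
        where open ≡-Reasoning

      degree-W : ∀ b → r ≡ t ℕ.+ class-size (inj₂ b) ℕ.+ Σℕ (class-size ∘ inj₁)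
      degree-W b = toℚ-injective (begin
        toℚ r
          ≡⟨ degree-formula (inj₂ b) ⟩
        (Σℚ {t} (λ _ → 1ℚ) + Σℚ {s} (λ _ → 0ℚ))
          + (Σℚ (λ a → 1ℚ * size (twin (inj₁ a))) + Σℚ (λ b′ → 𝟙 (eqᵇ b b′) * size (twin (inj₂ b′))))
          ≡⟨ cong₂ _+_ (cong₂ _+_ (trans (Σℚ-const {t} 1ℚ) (*-identityʳ (toℚ t))) (Σℚ-0 {s}))
                       (cong₂ _+_ (sym (toℚ-Σ-class-sizes inj₁))
                                  (trans (Σℚ-indicatorˡ b (λ b′ → size (twin (inj₂ b′)))) (sym (toℚ-class-size (inj₂ b))))) ⟩
        (toℚ t + 0ℚ) + (toℚ (Σℕ (class-size ∘ inj₁)) + toℚ (class-size (inj₂ b)))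
          ≡⟨ solve 3 (λ x y z → (x :+ con 0ℚ) :+ (z :+ y) := x :+ y :+ z) refl (toℚ t) _ _ ⟩
        toℚ t + toℚ (class-size (inj₂ b)) + toℚ (Σℕ (class-size ∘ inj₁))
          ≡⟨ sym (trans (toℚ-+ (t ℕ.+ class-size (inj₂ b)) _) (cong (_+ _) (toℚ-+ t _))) ⟩
        toℚ (t ℕ.+ class-size (inj₂ b) ℕ.+ Σℕ (class-size ∘ inj₁)) ∎)
        where open ≡-Reasoning

      module Isomorphism (a₀ : Fin t) (b₀ : Fin s) where

        a b : ℕ
        a = class-size (inj₁ a₀)
        b = class-size (inj₂ b₀)

        bound : Fin t ⊎ Fin s → ℕ
        bound (inj₁ _) = a
        bound (inj₂ _) = b

        class-size≡bound : ∀ z → class-size z ≡ bound z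
        class-size≡bound (inj₁ a′) = ℕₚ.+-cancelˡ-≡ s (class-size (inj₁ a′)) a
          (ℕₚ.+-cancelʳ-≡ (Σℕ (class-size ∘ inj₂)) (s ℕ.+ class-size (inj₁ a′)) (s ℕ.+ a) (trans (sym (degree-V a′)) (degree-V a₀)))
        class-size≡bound (inj₂ b′) = ℕₚ.+-cancelˡ-≡ t (class-size (inj₂ b′)) b
          (ℕₚ.+-cancelʳ-≡ (Σℕ (class-size ∘ inj₁)) (t ℕ.+ class-size (inj₂ b′)) (t ℕ.+ b) (trans (sym (degree-W b′)) (degree-W b₀)))

        degree-equation-V : r ≡ s ℕ.+ a ℕ.+ s ℕ.* b
        degree-equation-V = trans (degree-V a₀) (cong (s ℕ.+ a ℕ.+_) (trans (Σℕ-cong (class-size≡bound ∘ inj₂)) (Σℕ-const {s} b)))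

        degree-equation-W : r ≡ t ℕ.+ b ℕ.+ t ℕ.* a
        degree-equation-W = trans (degree-W b₀) (cong (t ℕ.+ b ℕ.+_) (trans (Σℕ-cong (class-size≡bound ∘ inj₁)) (Σℕ-const {t} a)))

        H-vertex : Fin t ⊎ Fin s → GV t s a b
        H-vertex (inj₁ a′) = gv a′
        H-vertex (inj₂ b′) = gw b′

        class-vertex : ∀ z → Fin (bound z) → GV t s a b
        class-vertex (inj₁ a′) p = gx a′ p
        class-vertex (inj₂ b′) q = gy b′ q

        in-own-class : ∀ {i c} → type-of i ≡ c → in-class c i ≡ true
        in-own-class {c = c} refl = eqType-refl c

        position : ∀ i z → type-of i ≡ twin z → Fin (bound z)
        position i z e = fromℕ< (subst (rank (in-class (twin z)) i ℕ.<_) (class-size≡bound z) (rank<count _ i (in-own-class e)))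

        position-injective : ∀ i j z (e : type-of i ≡ twin z) (e′ : type-of j ≡ twin z) → position i z e ≡ position j z e′ → i ≡ j
        position-injective i j z e e′ p≡p′ = rank-injective (in-class (twin z)) i j (in-own-class e) (in-own-class e′)
          (trans (sym (Finₚ.toℕ-fromℕ< _)) (trans (cong toℕ p≡p′) (Finₚ.toℕ-fromℕ< _)))

        encode : ∀ i c → type-of i ≡ c → GV t s a b
        encode i (vertex z) _ = H-vertex z
        encode i (twin z) e = class-vertex z (position i z e)

        φ : Fin N → GV t s a b
        φ i = encode i (type-of i) refl

        type-of-GV : GV t s a b → VType t s
        type-of-GV (gv a′) = vertex (inj₁ a′)
        type-of-GV (gw b′) = vertex (inj₂ b′)
        type-of-GV (gx a′ _) = twin (inj₁ a′)
        type-of-GV (gy b′ _) = twin (inj₂ b′)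

        position-of-GV : GV t s a b → ℕ
        position-of-GV (gx _ p) = toℕ p
        position-of-GV (gy _ q) = toℕ q
        position-of-GV _ = 0

        type-of-encode : ∀ i c (e : type-of i ≡ c) → type-of-GV (encode i c e) ≡ c
        type-of-encode i (vertex (inj₁ _)) _ = refl
        type-of-encode i (vertex (inj₂ _)) _ = refl
        type-of-encode i (twin (inj₁ _)) _ = refl
        type-of-encode i (twin (inj₂ _)) _ = refl

        position-of-encode : ∀ i z (e : type-of i ≡ twin z) → position-of-GV (encode i (twin z) e) ≡ toℕ (position i z e)
        position-of-encode i (inj₁ _) _ = refl
        position-of-encode i (inj₂ _) _ = refl

        rank-of-φ : ∀ i z → type-of i ≡ twin z → position-of-GV (φ i) ≡ rank (in-class (twin z)) i
        rank-of-φ i z ti = rank-of-encode (type-of i) refl ti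
          where
          rank-of-encode : ∀ c (e : type-of i ≡ c) → c ≡ twin z → position-of-GV (encode i c e) ≡ rank (in-class (twin z)) i
          rank-of-encode .(twin z) e refl = trans (position-of-encode i z e) (Finₚ.toℕ-fromℕ< _)

        φ-injective : ∀ i j → φ i ≡ φ j → i ≡ j
        φ-injective i j φi≡φj = same-type (type-of i) refl
          (trans (sym (type-of-encode j (type-of j) refl)) (trans (cong type-of-GV (sym φi≡φj)) (type-of-encode i (type-of i) refl)))
          where
          same-type : ∀ c → type-of i ≡ c → type-of j ≡ c → i ≡ j
          same-type (vertex z) ti tj = trans (type-vertex⇒f i z ti) (sym (type-vertex⇒f j z tj))
          same-type (twin z) ti tj = rank-injective (in-class (twin z)) i j (in-own-class ti) (in-own-class tj)
            (trans (sym (rank-of-φ i z ti)) (trans (cong position-of-GV φi≡φj) (rank-of-φ j z tj)))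

        φ-f : ∀ z → φ (f z) ≡ H-vertex z
        φ-f z = encode-vertex (type-of (f z)) refl (type-of-f z)
          where
          encode-vertex : ∀ c (e : type-of (f z) ≡ c) → c ≡ vertex z → encode (f z) c e ≡ H-vertex z
          encode-vertex .(vertex z) e refl = refl

        φ-onto-class : ∀ z (p : Fin (bound z)) → ∃ λ i → φ i ≡ class-vertex z p
        φ-onto-class z p with rank-surjective (in-class (twin z)) (toℕ p)
                                (subst (toℕ p ℕ.<_) (sym (class-size≡bound z)) (Finₚ.toℕ<n p))
        ... | i , i-in-class , rank≡p = i , encode-twin (type-of i) refl (sym (eqType⇒≡ i-in-class))
          where
          encode-twin : ∀ c (e : type-of i ≡ c) → c ≡ twin z → encode i c e ≡ class-vertex z p
          encode-twin .(twin z) e refl = cong (class-vertex z) (Finₚ.toℕ-injective (trans (Finₚ.toℕ-fromℕ< _) rank≡p))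

        φ-surjective : ∀ g → ∃ λ i → φ i ≡ g
        φ-surjective (gv a′) = f (inj₁ a′) , φ-f (inj₁ a′)
        φ-surjective (gw b′) = f (inj₂ b′) , φ-f (inj₂ b′)
        φ-surjective (gx a′ p) = φ-onto-class (inj₁ a′) p
        φ-surjective (gy b′ q) = φ-onto-class (inj₂ b′) q

        type-adj≡GAdj : ∀ i j c c′ (e : type-of i ≡ c) (e′ : type-of j ≡ c′) → i ≢ j →
          type-adj c c′ ≡ GAdj (encode i c e) (encode j c′ e′)
        type-adj≡GAdj i j (vertex (inj₁ _)) (vertex (inj₁ _)) _ _ _ = refl
        type-adj≡GAdj i j (vertex (inj₁ _)) (vertex (inj₂ _)) _ _ _ = refl
        type-adj≡GAdj i j (vertex (inj₁ _)) (twin (inj₁ _)) _ _ _ = refl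
        type-adj≡GAdj i j (vertex (inj₁ _)) (twin (inj₂ _)) _ _ _ = refl
        type-adj≡GAdj i j (vertex (inj₂ _)) (vertex (inj₁ _)) _ _ _ = refl
        type-adj≡GAdj i j (vertex (inj₂ _)) (vertex (inj₂ _)) _ _ _ = refl
        type-adj≡GAdj i j (vertex (inj₂ _)) (twin (inj₁ _)) _ _ _ = refl
        type-adj≡GAdj i j (vertex (inj₂ _)) (twin (inj₂ _)) _ _ _ = refl
        type-adj≡GAdj i j (twin (inj₁ _)) (vertex (inj₁ _)) _ _ _ = refl
        type-adj≡GAdj i j (twin (inj₁ _)) (vertex (inj₂ _)) _ _ _ = refl
        type-adj≡GAdj i j (twin (inj₁ a₁)) (twin (inj₁ a₂)) e e′ i≢j =
          eqᵇ≡eqᵇ∧not a₁ a₂ _ _ λ { refl p≡p′ → i≢j (position-injective i j (inj₁ a₁) e e′ p≡p′) }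
        type-adj≡GAdj i j (twin (inj₁ _)) (twin (inj₂ _)) _ _ _ = refl
        type-adj≡GAdj i j (twin (inj₂ _)) (vertex (inj₁ _)) _ _ _ = refl
        type-adj≡GAdj i j (twin (inj₂ _)) (vertex (inj₂ _)) _ _ _ = refl
        type-adj≡GAdj i j (twin (inj₂ _)) (twin (inj₁ _)) _ _ _ = refl
        type-adj≡GAdj i j (twin (inj₂ b₁)) (twin (inj₂ b₂)) e e′ i≢j =
          eqᵇ≡eqᵇ∧not b₁ b₂ _ _ λ { refl q≡q′ → i≢j (position-injective i j (inj₂ b₁) e e′ q≡q′) }

        φ-adj : ∀ i j → adj G i j ≡ GAdj (φ i) (φ j)
        φ-adj i j with i Fin.≟ j
        ... | yes refl = trans (irrefl G i) (sym (GAdj-irrefl (φ i)))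
        ... | no i≢j = trans (adj≡type-adj i j i≢j) (type-adj≡GAdj i j (type-of i) (type-of j) refl refl i≢j)

        iso : IsoToG G t s a b
        iso = φ , φ-injective , φ-surjective , φ-adj

open Arithmetic
open StarSets
open import Data.Nat using (ℕ; suc; _≤_; _*_; _∸_; s≤s; z≤n)
open import Data.Fin using (zero)
open import Data.Nat.Properties using (≤-trans)
open import Data.Nat.Divisibility using (_∣_)
open import Data.Product using (Σ; _×_; _,_; proj₁; proj₂)
open import Data.Rational using (-_; 1ℚ)
open import Data.Fin.Subset using (_∈_)
open import Relation.Binary.PropositionalEquality using (_≡_)

theorem3p5 : (t s r : ℕ) → (ht : 2 ≤ t) → (hs : t ≤ s) → (G : Graph) → Regular G r
    → HasStarComplementK G (- 1ℚ) t s
    → modulus t s (≤-trans ht hs) ∣ suc r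
      × Σ ℕ (λ a → Σ ℕ (λ b →
          suc a * (t * s ∸ 1) ≡ suc r * (s ∸ 1)
        × suc b * (t * s ∸ 1) ≡ suc r * (t ∸ 1)
        × IsoToG G t s a b))
theorem3p5 t@(suc (suc t₂)) s@(suc (suc s₂)) r 2≤t@(s≤s (s≤s _)) t≤s@(s≤s (s≤s _)) G regular
  (X , (_ , ((basis , basis-ker , basis-independent) , _) , not-eigenvalue) , H) =
  /gcd-∣ _ (suc s₂) (suc t₂) (suc r) (suc a) (suc b) {{gcdNZ t s (≤-trans 2≤t t≤s)}} (gcd∣ts-1 (suc t₂) (suc s₂)) (proj₁ sizes) (proj₂ sizes)
  , a , b , proj₁ sizes , proj₂ sizes , iso
  where
  open StarComplement G regular X H
  twins : ∀ x → x ∈ X → Twin x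
  twins x x∈X = Eigenvector.classify x∈X
    (star-eigenvector G (- 1ℚ) X not-eigenvalue basis basis-ker basis-independent x x∈X) 2≤t (s≤s z≤n)
  open Types twins
  open Isomorphism zero zero
  sizes : suc a * (t * s ∸ 1) ≡ suc r * (s ∸ 1) × suc b * (t * s ∸ 1) ≡ suc r * (t ∸ 1)
  sizes = class-sizes (suc t₂) (suc s₂) a b r degree-equation-V degree-equation-W
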